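{- Let $N\ge2$ be an integer and let $c,d,k$ be positive integers with $\gcd(c,d)=1$ and $N\mid c$. Then $$\sum_{v\mid N}\frac{\mu(v)}{v}\left(s\!\left(d,\frac{vc}{N}\right)-s\!\left(d,\frac{vc}{N}+vkd\right)\right)=\frac{N^2k(d^2+1)}{12c(c+kNd)}\prod_{p\mid N}\left(1-p^{ -2}\right),$$ where the sum runs over positive divisors $v$ of $N$ and the product over primes $p$ dividing $N$.
   Context: $\mu$ is the Möbius function. For coprime integers $d$ and $c\ge1$, the classical Dedekind sum is $s(d,c)=\sum_{m=0}^{c-1}\left(\left(\frac{dm}{c}\right)\right)\left(\left(\frac mc\right)\right)$, where $((x))=x-\lfloor x\rfloor-\tfrac12$ for $x\in\mathbb{R}\setminus\mathbb{Z}$ and $((x))=0$ for $x\in\mathbb{Z}$. -}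

module Defs where

open import Data.Bool using (Bool; true; false; if_then_else_)
open import Data.Nat.DivMod as ℕ using ()
open import Data.Nat as ℕ using (ℕ; zero; suc; NonZero)
open import Data.Nat.Divisibility using (_∣?_)
open import Data.Nat.Primality using (prime?)
open import Data.Integer as ℤ using (ℤ; +_)
open import Data.Rational as ℚ using (ℚ; 0ℚ; 1ℚ; ½; ↧ₙ_; floor; _+_; _-_; _*_)
open import Data.List using (List; []; _∷_; filter; upTo; map; foldr; length)
open import Data.Bool.ListAction using (any)
open import Relation.Nullary.Decidable using (does; _×-dec_)

Σℚ : List ℚ → ℚ
Σℚ = foldr _+_ 0ℚ

Πℚ : List ℚ → ℚ
Πℚ = foldr _*_ 1ℚ

divisors : ℕ → List ℕ
divisors n = filter (λ v → v ∣? n) (map suc (upTo n))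

primeDivisors : ℕ → List ℕ
primeDivisors n = filter (λ p → prime? p ×-dec (p ∣? n)) (divisors n)

μ : ℕ → ℤ
μ n = if any (λ p → does ((p ℕ.* p) ∣? n)) (primeDivisors n)
        then + 0
        else (ℤ.- ℤ.1ℤ) ℤ.^ length (primeDivisors n)

saw : ℚ → ℚ
saw x with ↧ₙ x ℕ.≡ᵇ 1
... | true  = 0ℚ
... | false = (x - (floor x ℚ./ 1)) - ½

-- classical Dedekind sum s(d,c) = Σ_{m=0}^{c-1} ((dm/c)) ((m/c)), c ≥ 1
-- (junk value 0 for c = 0, never used under the theorem's hypotheses)
dedekind : ℤ → ℕ → ℚ
dedekind d zero = 0ℚ
dedekind d c@(suc _) = Σℚ (map (λ m → saw ((d ℤ.* + m) ℚ./ c) * saw ((+ m) ℚ./ c)) (upTo c))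

-- the rational number a / b (junk value 0 when b = 0)
_÷_ : ℤ → ℕ → ℚ
a ÷ zero = 0ℚ
a ÷ b@(suc _) = a ℚ./ b

-- natural-number quotient m / n (junk value 0 when n = 0); exact when n ∣ m
_div_ : ℕ → ℕ → ℕ
m div zero = 0
m div n@(suc _) = m ℕ./ n

{-# OPTIONS --safe #-}
module Submission where

-- Reciprocity, s(h,k) + s(k,h) = (h² + k² + 1)/(12hk) − 1/4 for coprime h, k, together with
-- s(b,d) = s(a,d) for b ≡ a (mod d), gives for b = a + md
--   s(d,a) − s(d,b) = m(d² + 1)/(12ab) − m/12.
-- For v ∣ N take a = vc/N and m = vk: the v-th summand becomes
--   μ(v)·v⁻²·N²k(d² + 1)/(12c(c + kNd)) − μ(v)·k/12,
-- and Σ_{v∣N} μ(v)F(v) = Π_{p∣N}(1 − F(p)) for completely multiplicative F, applied to F(v) = v⁻²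
-- and to F = 1 (whose product vanishes for N ≥ 2), finishes the proof.
-- Reciprocity is proved over ℤ for 4k²·s(h,k): permuting the residues hm mod k expresses it
-- through Σ_{m<k} m⌊hm/k⌋, and counting lattice points under the line y = hx/k relates that sum
-- to its counterpart with h and k exchanged.

module RangeSum where

  open import Data.Nat.Base using (ℕ; zero; suc; _<_; z<s; s<s)
  open import Data.Integer.Base using (ℤ; +_; 0ℤ; 1ℤ; _+_; _*_; _-_)
  import Data.Integer.Properties as ℤ
  open import Algebra.Properties.CommutativeSemigroup ℤ.+-commutativeSemigroup
    using () renaming (interchange to +-interchange)
  open import Data.Integer.Tactic.RingSolver using (solve-∀)
  open import Function.Base using (_∘_)
  open import Relation.Binary.PropositionalEquality
    using (_≡_; refl; sym; trans; cong; cong₂; module ≡-Reasoning)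
  open ≡-Reasoning

  ∑ : ℕ → (ℕ → ℤ) → ℤ
  ∑ zero    f = 0ℤ
  ∑ (suc n) f = f 0 + ∑ n (f ∘ suc)

  infix 5 ∑
  syntax ∑ n (λ i → e) = ∑[ i < n ] e

  ∑-cong : ∀ n {f g : ℕ → ℤ} → (∀ i → i < n → f i ≡ g i) → ∑ n f ≡ ∑ n g
  ∑-cong zero    eq = refl
  ∑-cong (suc n) eq = cong₂ _+_ (eq 0 z<s) (∑-cong n (λ i i<n → eq (suc i) (s<s i<n)))

  ∑-zero : ∀ n {f : ℕ → ℤ} → (∀ i → i < n → f i ≡ 0ℤ) → ∑ n f ≡ 0ℤ
  ∑-zero n eq = trans (∑-cong n eq) (∑-0 n)
    where
    ∑-0 : ∀ n → ∑[ _ < n ] 0ℤ ≡ 0ℤ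
    ∑-0 zero    = refl
    ∑-0 (suc n) = trans (ℤ.+-identityˡ _) (∑-0 n)

  ∑-distrib-+ : ∀ n (f g : ℕ → ℤ) → ∑[ i < n ] (f i + g i) ≡ ∑ n f + ∑ n g
  ∑-distrib-+ zero    f g = refl
  ∑-distrib-+ (suc n) f g = begin
    (f 0 + g 0) + (∑[ i < n ] (f (suc i) + g (suc i)))  ≡⟨ cong (_+_ (f 0 + g 0)) (∑-distrib-+ n (f ∘ suc) (g ∘ suc)) ⟩
    (f 0 + g 0) + (∑ n (f ∘ suc) + ∑ n (g ∘ suc))    ≡⟨ +-interchange (f 0) (g 0) _ _ ⟩
    (f 0 + ∑ n (f ∘ suc)) + (g 0 + ∑ n (g ∘ suc))    ∎

  *-distribˡ-∑ : ∀ n a (f : ℕ → ℤ) → a * ∑ n f ≡ ∑[ i < n ] (a * f i)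
  *-distribˡ-∑ zero    a f = ℤ.*-zeroʳ a
  *-distribˡ-∑ (suc n) a f = trans (ℤ.*-distribˡ-+ a (f 0) _) (cong (_+_ (a * f 0)) (*-distribˡ-∑ n a (f ∘ suc)))

  ∑-distrib-sub : ∀ n (f g : ℕ → ℤ) → ∑[ i < n ] (f i - g i) ≡ ∑ n f - ∑ n g
  ∑-distrib-sub zero    f g = refl
  ∑-distrib-sub (suc n) f g = begin
    (f 0 - g 0) + (∑[ i < n ] (f (suc i) - g (suc i)))  ≡⟨ cong (_+_ (f 0 - g 0)) (∑-distrib-sub n (f ∘ suc) (g ∘ suc)) ⟩
    (f 0 - g 0) + (∑ n (f ∘ suc) - ∑ n (g ∘ suc))    ≡⟨ regroup (f 0) (g 0) _ _ ⟩
    (f 0 + ∑ n (f ∘ suc)) - (g 0 + ∑ n (g ∘ suc))    ∎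
    where
    regroup : ∀ a b c d → (a - b) + (c - d) ≡ (a + c) - (b + d)
    regroup = solve-∀

  ∑-last : ∀ n (f : ℕ → ℤ) → ∑ (suc n) f ≡ ∑ n f + f n
  ∑-last zero    f = ℤ.+-comm (f 0) 0ℤ
  ∑-last (suc n) f = trans (cong (_+_ (f 0)) (∑-last n (f ∘ suc))) (sym (ℤ.+-assoc (f 0) _ _))

  ∑-comm : ∀ m n (f : ℕ → ℕ → ℤ) → ∑[ i < m ] ∑ n (f i) ≡ ∑[ j < n ] ∑[ i < m ] f i j
  ∑-comm zero    n f = sym (∑-zero n (λ _ _ → refl))
  ∑-comm (suc m) n f = begin
    ∑ n (f 0) + (∑[ i < m ] ∑ n (f (suc i)))        ≡⟨ cong (_+_ (∑ n (f 0))) (∑-comm m n (f ∘ suc)) ⟩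
    ∑ n (f 0) + (∑[ j < n ] ∑[ i < m ] f (suc i) j)  ≡⟨ ∑-distrib-+ n (f 0) _ ⟨
    ∑[ j < n ] ∑[ i < suc m ] f i j                ∎

  ∑-const : ∀ n a → ∑[ _ < n ] a ≡ a * + n
  ∑-const zero    a = sym (ℤ.*-zeroʳ a)
  ∑-const (suc n) a = begin
    a + (∑[ _ < n ] a)  ≡⟨ cong (_+_ a) (∑-const n a) ⟩
    a + a * + n       ≡⟨ step a (+ n) ⟩
    a * (1ℤ + + n)    ∎
    where
    step : ∀ a x → a + a * x ≡ a * (1ℤ + x)
    step = solve-∀

  ∑-id : ∀ n → + 2 * (∑[ m < n ] + m) ≡ + n * (+ n - 1ℤ)
  ∑-id zero    = refl
  ∑-id (suc n) = begin
    + 2 * (∑[ m < suc n ] + m)      ≡⟨ cong (+ 2 *_) (∑-last n (λ m → + m)) ⟩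
    + 2 * ((∑[ m < n ] + m) + + n)  ≡⟨ ℤ.*-distribˡ-+ (+ 2) (∑[ m < n ] + m) (+ n) ⟩
    + 2 * (∑[ m < n ] + m) + + 2 * + n ≡⟨ cong (λ x → x + + 2 * + n) (∑-id n) ⟩
    + n * (+ n - 1ℤ) + + 2 * + n     ≡⟨ step (+ n) ⟩
    (1ℤ + + n) * ((1ℤ + + n) - 1ℤ)   ∎
    where
    step : ∀ x → x * (x - 1ℤ) + + 2 * x ≡ (1ℤ + x) * ((1ℤ + x) - 1ℤ)
    step = solve-∀

  ∑-square : ∀ n → + 6 * (∑[ m < n ] + m * + m) ≡ + n * (+ n - 1ℤ) * (+ 2 * + n - 1ℤ)
  ∑-square zero    = refl
  ∑-square (suc n) = begin
    + 6 * (∑[ m < suc n ] + m * + m)                    ≡⟨ cong (+ 6 *_) (∑-last n (λ m → + m * + m)) ⟩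
    + 6 * ((∑[ m < n ] + m * + m) + + n * + n)          ≡⟨ ℤ.*-distribˡ-+ (+ 6) (∑[ m < n ] + m * + m) (+ n * + n) ⟩
    + 6 * (∑[ m < n ] + m * + m) + + 6 * (+ n * + n)    ≡⟨ cong (λ x → x + + 6 * (+ n * + n)) (∑-square n) ⟩
    + n * (+ n - 1ℤ) * (+ 2 * + n - 1ℤ) + + 6 * (+ n * + n) ≡⟨ step (+ n) ⟩
    (1ℤ + + n) * ((1ℤ + + n) - 1ℤ) * (+ 2 * (1ℤ + + n) - 1ℤ) ∎
    where
    step : ∀ x → x * (x - 1ℤ) * (+ 2 * x - 1ℤ) + + 6 * (x * x) ≡ (1ℤ + x) * ((1ℤ + x) - 1ℤ) * (+ 2 * (1ℤ + x) - 1ℤ)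
    step = solve-∀

  ∑-linear₂ : ∀ n a b (f g : ℕ → ℤ) → ∑[ i < n ] (a * f i + b * g i) ≡ a * ∑ n f + b * ∑ n g
  ∑-linear₂ n a b f g = begin
    ∑[ i < n ] (a * f i + b * g i)          ≡⟨ ∑-distrib-+ n (λ i → a * f i) (λ i → b * g i) ⟩
    (∑[ i < n ] a * f i) + (∑[ i < n ] b * g i)  ≡⟨ cong₂ _+_ (*-distribˡ-∑ n a f) (*-distribˡ-∑ n b g) ⟨
    a * ∑ n f + b * ∑ n g                    ∎

  ∑-linear₃ : ∀ n a b c (f g h : ℕ → ℤ) →
              ∑[ i < n ] (a * f i + b * g i + c * h i) ≡ a * ∑ n f + b * ∑ n g + c * ∑ n h
  ∑-linear₃ n a b c f g h = begin
    ∑[ i < n ] (a * f i + b * g i + c * h i)              ≡⟨ ∑-distrib-+ n (λ i → a * f i + b * g i) (λ i → c * h i) ⟩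
    (∑[ i < n ] (a * f i + b * g i)) + (∑[ i < n ] c * h i)  ≡⟨ cong₂ _+_ (∑-linear₂ n a b f g) (sym (*-distribˡ-∑ n c h)) ⟩
    a * ∑ n f + b * ∑ n g + c * ∑ n h                      ∎

module Fraction where

  open import Data.Nat.Base as ℕ using (ℕ; zero; suc; NonZero)
  open import Data.Integer.Base as ℤ using (ℤ; +_)
  open import Data.Rational.Base using (_+_; _*_; _-_; -_; toℚᵘ)
  open import Data.Rational.Properties
    using (toℚᵘ-injective; toℚᵘ-fromℚᵘ; toℚᵘ-homo-+; toℚᵘ-homo-*; toℚᵘ-homo‿-; 0/n≡0)
  open import Data.Rational.Unnormalised.Base as ℚᵘ using (mkℚᵘ; *≡*; _≃_)
  import Data.Rational.Unnormalised.Properties as ℚᵘ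
  open import Relation.Binary.PropositionalEquality using (_≡_; sym; trans; cong; module ≡-Reasoning)
  import Data.Integer.Properties as ℤ
  open import Data.Integer.Tactic.RingSolver using (solve-∀)
  open import Data.List.Base using (map; applyUpTo)
  open import Function.Base using (_∘_)
  open import Defs using (_÷_; Σℚ)
  open RangeSum

  toℚᵘ-÷ : ∀ i n .{{_ : NonZero n}} → toℚᵘ (i ÷ n) ≃ i ℚᵘ./ n
  toℚᵘ-÷ i (suc n) = toℚᵘ-fromℚᵘ (mkℚᵘ i n)

  ÷-cong : ∀ i j m n .{{_ : NonZero m}} .{{_ : NonZero n}} →
           i ℤ.* + n ≡ j ℤ.* + m → i ÷ m ≡ j ÷ n
  ÷-cong i j m@(suc _) n@(suc _) eq = toℚᵘ-injective (begin
    toℚᵘ (i ÷ m)  ≈⟨ toℚᵘ-÷ i m ⟩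
    i ℚᵘ./ m      ≈⟨ *≡* eq ⟩
    j ℚᵘ./ n      ≈⟨ ℚᵘ.≃-sym (toℚᵘ-÷ j n) ⟩
    toℚᵘ (j ÷ n)  ∎)
    where open ℚᵘ.≃-Reasoning

  ÷-+ : ∀ i j m n .{{_ : NonZero m}} .{{_ : NonZero n}} →
        i ÷ m + j ÷ n ≡ (i ℤ.* + n ℤ.+ j ℤ.* + m) ÷ (m ℕ.* n)
  ÷-+ i j m@(suc _) n@(suc _) = toℚᵘ-injective (begin
    toℚᵘ (i ÷ m + j ÷ n)                  ≈⟨ toℚᵘ-homo-+ (i ÷ m) (j ÷ n) ⟩
    toℚᵘ (i ÷ m) ℚᵘ.+ toℚᵘ (j ÷ n)        ≈⟨ ℚᵘ.+-cong (toℚᵘ-÷ i m) (toℚᵘ-÷ j n) ⟩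
    (i ℚᵘ./ m) ℚᵘ.+ (j ℚᵘ./ n)                ≈⟨ ℚᵘ.≃-sym (toℚᵘ-÷ (i ℤ.* + n ℤ.+ j ℤ.* + m) (m ℕ.* n)) ⟩
    toℚᵘ ((i ℤ.* + n ℤ.+ j ℤ.* + m) ÷ (m ℕ.* n)) ∎)
    where open ℚᵘ.≃-Reasoning

  ÷-* : ∀ i j m n .{{_ : NonZero m}} .{{_ : NonZero n}} →
        (i ÷ m) * (j ÷ n) ≡ (i ℤ.* j) ÷ (m ℕ.* n)
  ÷-* i j m@(suc _) n@(suc _) = toℚᵘ-injective (begin
    toℚᵘ ((i ÷ m) * (j ÷ n))              ≈⟨ toℚᵘ-homo-* (i ÷ m) (j ÷ n) ⟩
    toℚᵘ (i ÷ m) ℚᵘ.* toℚᵘ (j ÷ n)        ≈⟨ ℚᵘ.*-cong (toℚᵘ-÷ i m) (toℚᵘ-÷ j n) ⟩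
    (i ℚᵘ./ m) ℚᵘ.* (j ℚᵘ./ n)                ≈⟨ ℚᵘ.≃-sym (toℚᵘ-÷ (i ℤ.* j) (m ℕ.* n)) ⟩
    toℚᵘ ((i ℤ.* j) ÷ (m ℕ.* n))          ∎)
    where open ℚᵘ.≃-Reasoning

  ÷-neg : ∀ i n .{{_ : NonZero n}} → - (i ÷ n) ≡ (ℤ.- i) ÷ n
  ÷-neg i n@(suc _) = toℚᵘ-injective (begin
    toℚᵘ (- (i ÷ n))     ≈⟨ toℚᵘ-homo‿- (i ÷ n) ⟩
    ℚᵘ.- toℚᵘ (i ÷ n)    ≈⟨ ℚᵘ.-‿cong (toℚᵘ-÷ i n) ⟩
    ℚᵘ.- (i ℚᵘ./ n)      ≈⟨ ℚᵘ.≃-sym (toℚᵘ-÷ (ℤ.- i) n) ⟩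
    toℚᵘ ((ℤ.- i) ÷ n)   ∎)
    where open ℚᵘ.≃-Reasoning

  ÷-sub : ∀ i j m n .{{_ : NonZero m}} .{{_ : NonZero n}} →
        i ÷ m - j ÷ n ≡ (i ℤ.* + n ℤ.- j ℤ.* + m) ÷ (m ℕ.* n)
  ÷-sub i j m n = begin
    i ÷ m - j ÷ n                               ≡⟨ cong (λ x → i ÷ m + x) (÷-neg j n) ⟩
    i ÷ m + (ℤ.- j) ÷ n                         ≡⟨ ÷-+ i (ℤ.- j) m n ⟩
    (i ℤ.* + n ℤ.+ (ℤ.- j) ℤ.* + m) ÷ (m ℕ.* n) ≡⟨ cong (λ x → (i ℤ.* + n ℤ.+ x) ÷ (m ℕ.* n)) (sym (ℤ.neg-distribˡ-* j (+ m))) ⟩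
    (i ℤ.* + n ℤ.- j ℤ.* + m) ÷ (m ℕ.* n)       ∎
    where open ≡-Reasoning

  Σℚ-÷ : ∀ n .{{_ : NonZero n}} (f : ℕ → ℤ) (g : ℕ → ℕ) k →
         Σℚ (map (λ i → f i ÷ n) (applyUpTo g k)) ≡ (∑[ i < k ] f (g i)) ÷ n
  Σℚ-÷ n@(suc _) f g zero    = sym (0/n≡0 n)
  Σℚ-÷ n@(suc _) f g (suc k) = begin
    f (g 0) ÷ n + Σℚ (map (λ i → f i ÷ n) (applyUpTo (g ∘ suc) k))  ≡⟨ cong (λ x → f (g 0) ÷ n + x) (Σℚ-÷ n f (g ∘ suc) k) ⟩
    f (g 0) ÷ n + S ÷ n                                               ≡⟨ ÷-+ (f (g 0)) S n n ⟩
    (f (g 0) ℤ.* + n ℤ.+ S ℤ.* + n) ÷ (n ℕ.* n)                       ≡⟨ ÷-cong (f (g 0) ℤ.* + n ℤ.+ S ℤ.* + n) (f (g 0) ℤ.+ S) (n ℕ.* n) n common-denominator ⟩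
    (f (g 0) ℤ.+ S) ÷ n                                               ∎
    where
    open ≡-Reasoning
    S = ∑[ i < k ] f (g (suc i))
    common-denominator : (f (g 0) ℤ.* + n ℤ.+ S ℤ.* + n) ℤ.* + n ≡ (f (g 0) ℤ.+ S) ℤ.* + (n ℕ.* n)
    common-denominator = trans (identity (f (g 0)) S (+ n)) (cong (ℤ._*_ (f (g 0) ℤ.+ S)) (sym (ℤ.pos-* n n)))
      where
      identity : ∀ x y m → (x ℤ.* m ℤ.+ y ℤ.* m) ℤ.* m ≡ (x ℤ.+ y) ℤ.* (m ℤ.* m)
      identity = solve-∀

  ÷-cong-ℕ : ∀ a b m n .{{_ : NonZero m}} .{{_ : NonZero n}} → a ℕ.* n ≡ b ℕ.* m → (+ a) ÷ m ≡ (+ b) ÷ n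
  ÷-cong-ℕ a b m n eq = ÷-cong (+ a) (+ b) m n (trans (sym (ℤ.pos-* a n)) (trans (cong +_ eq) (ℤ.pos-* b m)))

  ÷-*-ℕ : ∀ a b m n .{{_ : NonZero m}} .{{_ : NonZero n}} → ((+ a) ÷ m) * ((+ b) ÷ n) ≡ (+ (a ℕ.* b)) ÷ (m ℕ.* n)
  ÷-*-ℕ a b m@(suc _) n@(suc _) = trans (÷-* (+ a) (+ b) m n) (cong (_÷ (m ℕ.* n)) (sym (ℤ.pos-* a b)))

module Residue where

  open import Data.Nat.Base as ℕ using (ℕ; zero; suc; _+_; _*_; _∸_; _<_; _≤_; NonZero)
  import Data.Nat.Properties as ℕ
  open import Data.Nat.DivMod using (_%_; _/_; m%n<n; m≡m%n+[m/n]*n)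
  open import Data.Nat.Divisibility using (_∣_; divides; ∣⇒≤)
  open import Data.Nat.Coprimality using (Coprime; coprime-divisor)
  open import Data.Integer.Base as ℤ using (ℤ)
  import Data.Integer.Properties as ℤ
  open import Data.Fin.Base using (Fin; toℕ; fromℕ<; punchOut)
  open import Data.Fin.Properties using (_≟_; any?; punchOut-injective; injective⇒≤; toℕ-fromℕ<; toℕ-injective; toℕ<n)
  open import Data.Fin.Permutation using (Permutation; permutation)
  open import Data.Product.Base using (∃; _,_; proj₁; proj₂)
  open import Data.Sum.Base using (inj₁; inj₂)
  open import Function.Base using (_∘_)
  open import Function.Definitions using (Injective)
  open import Relation.Nullary.Decidable using (yes; no)
  open import Relation.Nullary.Negation using (contradiction)
  open import Relation.Binary.PropositionalEquality
    using (_≡_; refl; sym; trans; cong; cong₂; subst; module ≡-Reasoning)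
  open import Algebra.Properties.CommutativeMonoid.Sum ℤ.+-0-commutativeMonoid
    using (sum; sum-permute; sum-cong-≗)
  open RangeSum

  ∑≡sum : ∀ n (f : ℕ → ℤ) → ∑ n f ≡ sum (f ∘ toℕ {n})
  ∑≡sum zero    f = refl
  ∑≡sum (suc n) f = cong (ℤ._+_ (f 0)) (∑≡sum n (f ∘ suc))

  injective⇒surjective : ∀ {n} {f : Fin n → Fin n} → Injective _≡_ _≡_ f → ∀ j → ∃ λ i → f i ≡ j
  injective⇒surjective {suc n} {f} f-inj j with any? (λ i → f i ≟ j)
  ... | yes hit  = hit
  ... | no  miss = contradiction (injective⇒≤ g-inj) (ℕ.<-irrefl refl)
    where
    g : Fin (suc n) → Fin n
    g i = punchOut {i = j} {j = f i} (λ j≡fi → miss (i , sym j≡fi))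
    g-inj : Injective _≡_ _≡_ g
    g-inj {x} {y} = f-inj ∘ punchOut-injective {i = j} _ _

  ∑-permute : ∀ n (σ : ℕ → ℕ) → (∀ i → i < n → σ i < n) →
              (∀ i j → i < n → j < n → σ i ≡ σ j → i ≡ j) →
              (F : ℕ → ℤ) → ∑ n (F ∘ σ) ≡ ∑ n F
  ∑-permute n σ σ<n σ-inj F = begin
    ∑ n (F ∘ σ)                        ≡⟨ ∑≡sum n (F ∘ σ) ⟩
    sum {n} (F ∘ σ ∘ toℕ)               ≡⟨ sum-cong-≗ {n} (λ i → cong F (sym (toℕ-fromℕ< (σ<n (toℕ i) (toℕ<n i))))) ⟩
    sum {n} (F ∘ toℕ ∘ σ′)              ≡⟨ sum-permute (F ∘ toℕ) π ⟨
    sum {n} (F ∘ toℕ)                   ≡⟨ ∑≡sum n F ⟨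
    ∑ n F                               ∎
    where
    open ≡-Reasoning
    σ′ : Fin n → Fin n
    σ′ i = fromℕ< (σ<n (toℕ i) (toℕ<n i))
    σ′-inj : Injective _≡_ _≡_ σ′
    σ′-inj {x} {y} eq = toℕ-injective (σ-inj _ _ (toℕ<n x) (toℕ<n y)
      (trans (sym (toℕ-fromℕ< _)) (trans (cong toℕ eq) (toℕ-fromℕ< _))))
    σ′⁻¹ : Fin n → Fin n
    σ′⁻¹ = proj₁ ∘ injective⇒surjective σ′-inj
    π : Permutation n n
    π = permutation σ′ σ′⁻¹ (proj₂ ∘ injective⇒surjective σ′-inj)
                             (λ x → σ′-inj (proj₂ (injective⇒surjective σ′-inj (σ′ x))))

  %≡%⇒∣∸ : ∀ a b k .{{_ : NonZero k}} → a % k ≡ b % k → k ∣ a ∸ b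
  %≡%⇒∣∸ a b k eq = divides (a / k ∸ b / k) (begin
    a ∸ b                                      ≡⟨ cong₂ _∸_ (m≡m%n+[m/n]*n a k) (m≡m%n+[m/n]*n b k) ⟩
    (a % k + a / k * k) ∸ (b % k + b / k * k)  ≡⟨ cong (λ x → (x + a / k * k) ∸ (b % k + b / k * k)) eq ⟩
    (b % k + a / k * k) ∸ (b % k + b / k * k)  ≡⟨ ℕ.[m+n]∸[m+o]≡n∸o (b % k) _ _ ⟩
    a / k * k ∸ b / k * k                      ≡⟨ ℕ.*-distribʳ-∸ k (a / k) (b / k) ⟨
    (a / k ∸ b / k) * k                        ∎)
    where open ≡-Reasoning

  ∣∧<⇒≡0 : ∀ {d x} → d ∣ x → x < d → x ≡ 0
  ∣∧<⇒≡0 {x = zero}  _   _   = refl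
  ∣∧<⇒≡0 {x = suc x} d∣x x<d = contradiction (∣⇒≤ d∣x) (ℕ.<⇒≱ x<d)

  *-%-injective-≤ : ∀ h k .{{_ : NonZero k}} → Coprime k h → ∀ {i j} → j ≤ i → i < k →
                    (h * i) % k ≡ (h * j) % k → j ≡ i
  *-%-injective-≤ h k k⊥h {i} {j} j≤i i<k eq =
    ℕ.≤-antisym j≤i (ℕ.m∸n≡0⇒m≤n (∣∧<⇒≡0 k∣i∸j (ℕ.≤-<-trans (ℕ.m∸n≤m i j) i<k)))
    where
    k∣i∸j : k ∣ i ∸ j
    k∣i∸j = coprime-divisor k⊥h (subst (k ∣_) (sym (ℕ.*-distribˡ-∸ h i j)) (%≡%⇒∣∸ (h * i) (h * j) k eq))

  *-%-injective : ∀ h k .{{_ : NonZero k}} → Coprime k h → ∀ {i j} → i < k → j < k →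
                  (h * i) % k ≡ (h * j) % k → i ≡ j
  *-%-injective h k k⊥h {i} {j} i<k j<k eq with ℕ.≤-total j i
  ... | inj₁ j≤i = sym (*-%-injective-≤ h k k⊥h j≤i i<k eq)
  ... | inj₂ i≤j = *-%-injective-≤ h k k⊥h i≤j j<k (sym eq)

  ∑-*-%-permute : ∀ h k .{{_ : NonZero k}} → Coprime k h → (F : ℕ → ℤ) →
                  ∑[ m < k ] F ((h * m) % k) ≡ ∑ k F
  ∑-*-%-permute h k k⊥h = ∑-permute k (λ m → (h * m) % k) (λ m _ → m%n<n (h * m) k)
    (λ i j i<k j<k → *-%-injective h k k⊥h i<k j<k)

module Sawtooth where

  open import Data.Nat.Base as ℕ using (ℕ; zero; suc; NonZero)
  import Data.Nat.Properties as ℕ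
  open import Data.Nat.DivMod using (_%_; _/_; m≡m%n+[m/n]*n; m*n/o*n≡m/o; /-congʳ)
  open import Data.Nat.Divisibility using (_∣_; divides; ∣-refl; n∣m⇒m%n≡0)
  open import Data.Product.Base using (_,_)
  open import Data.Nat.Coprimality as Coprime using (Coprime)
  open import Data.Integer.GCD using (gcd)
  open import Data.Integer.Base as ℤ using (ℤ; +_; -[1+_]; 0ℤ; 1ℤ)
  import Data.Integer.Properties as ℤ
  open import Data.Integer.Tactic.RingSolver using (solve-∀)
  open import Data.Rational.Base using (mkℚ; 0ℚ; ½; ↥_; ↧_; floor; _*_; _-_)
  open import Data.Rational.Properties using (↥p/↧p≡p; 0/n≡0; ↥-/; ↧-/)
  open import Relation.Nullary.Negation using (contradiction)
  open import Relation.Binary.PropositionalEquality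
    using (_≡_; _≢_; refl; sym; trans; cong; cong₂; module ≡-Reasoning)
  open import Data.List.Base using (map; upTo)
  open import Data.List.Properties using (map-cong)
  open import Function.Base using (id)
  open import Defs using (saw; dedekind; Σℚ; _÷_)
  open RangeSum
  open Fraction

  -- sawNum k r = 2k·((r/k)) for 0 ≤ r < k
  sawNum : ℕ → ℕ → ℤ
  sawNum k zero    = 0ℤ
  sawNum k (suc r) = + 2 ℤ.* + suc r ℤ.- + k

  sawNum-≢0 : ∀ k r → r ≢ 0 → sawNum k r ≡ + 2 ℤ.* + r ℤ.- + k
  sawNum-≢0 k zero    r≢0 = contradiction refl r≢0
  sawNum-≢0 k (suc r) _   = refl

  cross⇒/≡/ : ∀ P a k D .{{_ : NonZero k}} .{{_ : NonZero D}} → P ℕ.* k ≡ a ℕ.* D → P / D ≡ a / k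
  cross⇒/≡/ P a k@(suc _) D@(suc _) eq = begin
    P / D                 ≡⟨ m*n/o*n≡m/o P k D ⟨
    (P ℕ.* k) / (D ℕ.* k) ≡⟨ cong (λ x → x / (D ℕ.* k)) eq ⟩
    (a ℕ.* D) / (D ℕ.* k) ≡⟨ /-congʳ {m = a ℕ.* D} (ℕ.*-comm D k) ⟩
    (a ℕ.* D) / (k ℕ.* D) ≡⟨ m*n/o*n≡m/o a D k ⟩
    a / k                 ∎
    where open ≡-Reasoning

  fractional-part : ∀ a k .{{_ : NonZero k}} →
                    ((+ a) ÷ k - (+ (a / k)) ÷ 1) - ½ ≡ (+ 2 ℤ.* + (a % k) ℤ.- + k) ÷ (2 ℕ.* k)
  fractional-part a k@(suc _) = begin
    ((+ a) ÷ k - (+ q) ÷ 1) - (+ 1) ÷ 2                    ≡⟨ cong (_- (+ 1) ÷ 2) (÷-sub (+ a) (+ q) k 1) ⟩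
    (+ a ℤ.* 1ℤ ℤ.- + q ℤ.* + k) ÷ (k ℕ.* 1) - (+ 1) ÷ 2  ≡⟨ ÷-sub (+ a ℤ.* 1ℤ ℤ.- + q ℤ.* + k) (+ 1) (k ℕ.* 1) 2 ⟩
    n ÷ (k ℕ.* 1 ℕ.* 2)                                    ≡⟨ ÷-cong n (+ 2 ℤ.* + r ℤ.- + k) (k ℕ.* 1 ℕ.* 2) (2 ℕ.* k) cross-identity ⟩
    (+ 2 ℤ.* + r ℤ.- + k) ÷ (2 ℕ.* k)                      ∎
    where
    open ≡-Reasoning
    q = a / k
    r = a % k
    n = (+ a ℤ.* 1ℤ ℤ.- + q ℤ.* + k) ℤ.* + 2 ℤ.- 1ℤ ℤ.* + (k ℕ.* 1)
    cast-k : ∀ m → + (k ℕ.* 1 ℕ.* m) ≡ + k ℤ.* + m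
    cast-k m = trans (cong (λ x → + (x ℕ.* m)) (ℕ.*-identityʳ k)) (ℤ.pos-* k m)
    a≡r+qk : + a ≡ + r ℤ.+ + q ℤ.* + k
    a≡r+qk = trans (cong +_ (m≡m%n+[m/n]*n a k)) (trans (ℤ.pos-+ r (q ℕ.* k)) (cong (ℤ._+_ (+ r)) (ℤ.pos-* q k)))
    cross-identity : n ℤ.* + (2 ℕ.* k) ≡ (+ 2 ℤ.* + r ℤ.- + k) ℤ.* + (k ℕ.* 1 ℕ.* 2)
    cross-identity = begin
      n ℤ.* + (2 ℕ.* k)
        ≡⟨ cong₂ (λ u v → ((u ℤ.* 1ℤ ℤ.- + q ℤ.* + k) ℤ.* + 2 ℤ.- 1ℤ ℤ.* v) ℤ.* + (2 ℕ.* k)) a≡r+qk (cong +_ (ℕ.*-identityʳ k)) ⟩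
      (((+ r ℤ.+ + q ℤ.* + k) ℤ.* 1ℤ ℤ.- + q ℤ.* + k) ℤ.* + 2 ℤ.- 1ℤ ℤ.* + k) ℤ.* + (2 ℕ.* k)
        ≡⟨ cong (ℤ._*_ (((+ r ℤ.+ + q ℤ.* + k) ℤ.* 1ℤ ℤ.- + q ℤ.* + k) ℤ.* + 2 ℤ.- 1ℤ ℤ.* + k)) (ℤ.pos-* 2 k) ⟩
      (((+ r ℤ.+ + q ℤ.* + k) ℤ.* 1ℤ ℤ.- + q ℤ.* + k) ℤ.* + 2 ℤ.- 1ℤ ℤ.* + k) ℤ.* (+ 2 ℤ.* + k)
        ≡⟨ identity (+ r) (+ q) (+ k) ⟩
      (+ 2 ℤ.* + r ℤ.- + k) ℤ.* (+ k ℤ.* + 2)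
        ≡⟨ cong (ℤ._*_ (+ 2 ℤ.* + r ℤ.- + k)) (cast-k 2) ⟨
      (+ 2 ℤ.* + r ℤ.- + k) ℤ.* + (k ℕ.* 1 ℕ.* 2) ∎
      where
      identity : ∀ r q k → (((r ℤ.+ q ℤ.* k) ℤ.* 1ℤ ℤ.- q ℤ.* k) ℤ.* + 2 ℤ.- 1ℤ ℤ.* k) ℤ.* (+ 2 ℤ.* k)
                         ≡ (+ 2 ℤ.* r ℤ.- k) ℤ.* (k ℤ.* + 2)
      identity = solve-∀

  coprime-cross⇒%≢0 : ∀ P a k D .{{_ : NonZero k}} → Coprime P (suc (suc D)) →
                      P ℕ.* k ≡ a ℕ.* suc (suc D) → a % k ≢ 0
  coprime-cross⇒%≢0 P a k D P⊥D+2 cross a%k≡0 = contradiction (P⊥D+2 (D+2∣P , ∣-refl)) λ ()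
    where
    open ≡-Reasoning
    q = a / k
    a≡qk : a ≡ q ℕ.* k
    a≡qk = trans (m≡m%n+[m/n]*n a k) (cong (ℕ._+ q ℕ.* k) a%k≡0)
    D+2∣P : suc (suc D) ∣ P
    D+2∣P = divides q (ℕ.*-cancelʳ-≡ P (q ℕ.* suc (suc D)) k (begin
      P ℕ.* k                   ≡⟨ cross ⟩
      a ℕ.* suc (suc D)         ≡⟨ cong (ℕ._* suc (suc D)) a≡qk ⟩
      q ℕ.* k ℕ.* suc (suc D)   ≡⟨ ℕ.*-assoc q k _ ⟩
      q ℕ.* (k ℕ.* suc (suc D)) ≡⟨ cong (q ℕ.*_) (ℕ.*-comm k _) ⟩
      q ℕ.* (suc (suc D) ℕ.* k) ≡⟨ ℕ.*-assoc q _ k ⟨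
      q ℕ.* suc (suc D) ℕ.* k   ∎))

  saw-cross : ∀ x a k .{{_ : NonZero k}} → ↥ x ℤ.* + k ≡ + a ℤ.* ↧ x →
              saw x ≡ sawNum k (a % k) ÷ (2 ℕ.* k)
  saw-cross (mkℚ -[1+ P ] D _) a k@(suc _) cross = contradiction (trans cross (sym (ℤ.pos-* a (suc D)))) neg≢pos
    where
    neg≢pos : ∀ {n} → -[1+ P ] ℤ.* + k ≢ + n
    neg≢pos ()
  saw-cross (mkℚ (+ P) zero _) a k@(suc _) cross = begin
    0ℚ                           ≡⟨ 0/n≡0 (2 ℕ.* k) ⟨
    0ℤ ÷ (2 ℕ.* k)               ≡⟨ cong (λ r → sawNum k r ÷ (2 ℕ.* k)) a%k≡0 ⟨
    sawNum k (a % k) ÷ (2 ℕ.* k) ∎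
    where
    open ≡-Reasoning
    a%k≡0 : a % k ≡ 0
    a%k≡0 = n∣m⇒m%n≡0 a k (divides P (ℤ.+-injective (trans (sym (ℤ.*-identityʳ (+ a))) (trans (sym cross) (sym (ℤ.pos-* P k))))))
  saw-cross x@(mkℚ (+ P) (suc D) P⊥D+2) a k@(suc _) cross = begin
    (x - floor x ÷ 1) - ½                 ≡⟨ cong₂ (λ u v → (u - v ÷ 1) - ½) x≡a÷k floor≡a/k ⟩
    ((+ a) ÷ k - (+ (a / k)) ÷ 1) - ½     ≡⟨ fractional-part a k ⟩
    (+ 2 ℤ.* + (a % k) ℤ.- + k) ÷ (2 ℕ.* k) ≡⟨ cong (_÷ (2 ℕ.* k)) (sawNum-≢0 k (a % k) a%k≢0) ⟨
    sawNum k (a % k) ÷ (2 ℕ.* k)          ∎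
    where
    open ≡-Reasoning
    cross′ : P ℕ.* k ≡ a ℕ.* suc (suc D)
    cross′ = ℤ.+-injective (trans (ℤ.pos-* P k) (trans cross (sym (ℤ.pos-* a (suc (suc D))))))
    x≡a÷k : x ≡ (+ a) ÷ k
    x≡a÷k = trans (sym (↥p/↧p≡p x)) (÷-cong (+ P) (+ a) (suc (suc D)) k cross)
    floor≡a/k : floor x ≡ + (a / k)
    floor≡a/k = trans (ℤ.*-identityˡ _) (cong +_ (cross⇒/≡/ P a k (suc (suc D)) cross′))
    a%k≢0 : a % k ≢ 0
    a%k≢0 = coprime-cross⇒%≢0 P a k D (Coprime.recompute P⊥D+2) cross′

  saw-/ : ∀ a k .{{_ : NonZero k}} → saw ((+ a) ÷ k) ≡ sawNum k (a % k) ÷ (2 ℕ.* k)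
  saw-/ a k@(suc _) = saw-cross x a k (begin
    ↥ x ℤ.* + k            ≡⟨ cong (ℤ._*_ (↥ x)) (↧-/ (+ a) k) ⟨
    ↥ x ℤ.* (↧ x ℤ.* g)    ≡⟨ swap (↥ x) (↧ x) g ⟩
    (↥ x ℤ.* g) ℤ.* ↧ x    ≡⟨ cong (ℤ._* ↧ x) (↥-/ (+ a) k) ⟩
    + a ℤ.* ↧ x            ∎)
    where
    open ≡-Reasoning
    x = (+ a) ÷ k
    g = gcd (+ a) (+ k)
    swap : ∀ u v w → u ℤ.* (v ℤ.* w) ≡ (u ℤ.* w) ℤ.* v
    swap = solve-∀

  dedekindℤ : ℕ → (k : ℕ) → .{{_ : NonZero k}} → ℤ
  dedekindℤ h k = ∑[ m < k ] sawNum k ((h ℕ.* m) % k) ℤ.* sawNum k (m % k)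

  dedekind≡dedekindℤ÷ : ∀ h k .{{_ : NonZero k}} →
                         dedekind (+ h) k ≡ dedekindℤ h k ÷ (2 ℕ.* k ℕ.* (2 ℕ.* k))
  dedekind≡dedekindℤ÷ h k@(suc _) = begin
    Σℚ (map (λ m → saw ((+ h ℤ.* + m) ÷ k) * saw ((+ m) ÷ k)) (upTo k))
      ≡⟨ cong Σℚ (map-cong term (upTo k)) ⟩
    Σℚ (map (λ m → term-numerator m ÷ (2 ℕ.* k ℕ.* (2 ℕ.* k))) (upTo k))
      ≡⟨ Σℚ-÷ (2 ℕ.* k ℕ.* (2 ℕ.* k)) term-numerator id k ⟩
    dedekindℤ h k ÷ (2 ℕ.* k ℕ.* (2 ℕ.* k)) ∎
    where
    open ≡-Reasoning
    term-numerator : ℕ → ℤ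
    term-numerator m = sawNum k ((h ℕ.* m) % k) ℤ.* sawNum k (m % k)
    term : ∀ m → saw ((+ h ℤ.* + m) ÷ k) * saw ((+ m) ÷ k) ≡ term-numerator m ÷ (2 ℕ.* k ℕ.* (2 ℕ.* k))
    term m = begin
      saw ((+ h ℤ.* + m) ÷ k) * saw ((+ m) ÷ k)   ≡⟨ cong (λ i → saw (i ÷ k) * saw ((+ m) ÷ k)) (ℤ.pos-* h m) ⟨
      saw ((+ (h ℕ.* m)) ÷ k) * saw ((+ m) ÷ k)   ≡⟨ cong₂ _*_ (saw-/ (h ℕ.* m) k) (saw-/ m k) ⟩
      sawNum k ((h ℕ.* m) % k) ÷ (2 ℕ.* k) * sawNum k (m % k) ÷ (2 ℕ.* k) ≡⟨ ÷-* (sawNum k ((h ℕ.* m) % k)) (sawNum k (m % k)) (2 ℕ.* k) (2 ℕ.* k) ⟩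
      term-numerator m ÷ (2 ℕ.* k ℕ.* (2 ℕ.* k))  ∎

module Reciprocity where

  open import Data.Nat.Base as ℕ using (ℕ; zero; suc; NonZero; _<_; _≤_; _⊓_; z<s; s<s; s≤s)
  open import Data.Nat.Properties using (_<?_; _≤?_)
  import Data.Nat.Properties as ℕ
  open import Data.Nat.DivMod using (_%_; _/_; m≡m%n+[m/n]*n; m<n⇒m%n≡m; m*n/n≡m; /-monoˡ-≤; m/n*n≤m; m<n*o⇒m/o<n; 0/n≡0)
  open import Data.Nat.Divisibility using (divides; ∣⇒≤; m%n≡0⇒n∣m)
  open import Data.Nat.Coprimality as Coprime using (Coprime; coprime-divisor)
  open import Data.Integer.Base using (ℤ; +_; 0ℤ; 1ℤ; _+_; _*_; -_; _-_)
  import Data.Integer.Properties as ℤ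
  open import Data.Integer.Tactic.RingSolver using (solve-∀)
  open import Data.Sum.Base using (inj₁; inj₂)
  open import Relation.Nullary.Decidable using (Dec; yes; no)
  open import Relation.Nullary.Negation using (¬_; contradiction)
  open import Relation.Binary.PropositionalEquality
    using (_≡_; _≢_; refl; sym; trans; cong; cong₂; subst; subst₂; module ≡-Reasoning)
  open ≡-Reasoning
  open RangeSum
  open Residue
  open Sawtooth

  χ : ∀ {P : Set} → Dec P → ℤ
  χ (yes _) = 1ℤ
  χ (no  _) = 0ℤ

  χ-yes : ∀ {P : Set} (P? : Dec P) → P → χ P? ≡ 1ℤ
  χ-yes (yes _) _ = refl
  χ-yes (no ¬p) p = contradiction p ¬p

  χ-no : ∀ {P : Set} (P? : Dec P) → ¬ P → χ P? ≡ 0ℤ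
  χ-no (yes p) ¬p = contradiction p ¬p
  χ-no (no  _) _  = refl

  χ-< : ∀ a b → χ (a <? b) ≡ 1ℤ - χ (b ≤? a)
  χ-< a b with a <? b | b ≤? a
  ... | yes a<b | yes b≤a = contradiction b≤a (ℕ.<⇒≱ a<b)
  ... | yes _   | no  _   = refl
  ... | no  _   | yes _   = refl
  ... | no  a≮b | no  b≰a = contradiction (ℕ.≰⇒> b≰a) a≮b

  ∑-count-≤ : ∀ n x → x < n → ∑[ m < n ] χ (m ≤? x) ≡ + suc x
  ∑-count-≤ (suc n) x x<1+n with ℕ.m≤n⇒m<n∨m≡n (ℕ.s≤s⁻¹ x<1+n)
  ... | inj₁ x<n = begin
    ∑[ m < suc n ] χ (m ≤? x)          ≡⟨ ∑-last n (λ m → χ (m ≤? x)) ⟩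
    (∑[ m < n ] χ (m ≤? x)) + χ (n ≤? x) ≡⟨ cong₂ _+_ (∑-count-≤ n x x<n) (χ-no (n ≤? x) (ℕ.<⇒≱ x<n)) ⟩
    + suc x + 0ℤ                       ≡⟨ ℤ.+-identityʳ (+ suc x) ⟩
    + suc x                            ∎
  ... | inj₂ refl = begin
    ∑[ m < suc n ] χ (m ≤? n)          ≡⟨ ∑-last n (λ m → χ (m ≤? n)) ⟩
    (∑[ m < n ] χ (m ≤? n)) + χ (n ≤? n) ≡⟨ cong₂ _+_ (∑-cong n (λ m m<n → χ-yes (m ≤? n) (ℕ.<⇒≤ m<n))) (χ-yes (n ≤? n) ℕ.≤-refl) ⟩
    (∑[ _ < n ] 1ℤ) + 1ℤ               ≡⟨ cong (_+ 1ℤ) (trans (∑-const n 1ℤ) (ℤ.*-identityˡ (+ n))) ⟩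
    + n + 1ℤ                           ≡⟨ ℤ.+-comm (+ n) 1ℤ ⟩
    + suc n                            ∎

  ∑-odd : ∀ J Q → ∑[ j < J ] χ (j <? Q) * (+ 2 * + j + 1ℤ) ≡ + (J ⊓ Q) * + (J ⊓ Q)
  ∑-odd zero    Q = refl
  ∑-odd (suc J) Q with J <? Q
  ... | yes J<Q = begin
    ∑[ j < suc J ] χ (j <? Q) * (+ 2 * + j + 1ℤ)                       ≡⟨ ∑-last J _ ⟩
    (∑[ j < J ] χ (j <? Q) * (+ 2 * + j + 1ℤ)) + χ (J <? Q) * (+ 2 * + J + 1ℤ)
      ≡⟨ cong₂ (λ s c → s + c * (+ 2 * + J + 1ℤ)) (∑-odd J Q) (χ-yes (J <? Q) J<Q) ⟩
    + (J ⊓ Q) * + (J ⊓ Q) + 1ℤ * (+ 2 * + J + 1ℤ)                        ≡⟨ cong (λ m → + m * + m + 1ℤ * (+ 2 * + J + 1ℤ)) (ℕ.m≤n⇒m⊓n≡m (ℕ.<⇒≤ J<Q)) ⟩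
    + J * + J + 1ℤ * (+ 2 * + J + 1ℤ)                                    ≡⟨ next-square (+ J) ⟩
    + suc J * + suc J                                                    ≡⟨ cong (λ m → + m * + m) (ℕ.m≤n⇒m⊓n≡m J<Q) ⟨
    + (suc J ⊓ Q) * + (suc J ⊓ Q)                                        ∎
    where
    next-square : ∀ x → x * x + 1ℤ * (+ 2 * x + 1ℤ) ≡ (1ℤ + x) * (1ℤ + x)
    next-square = solve-∀
  ... | no J≮Q = begin
    ∑[ j < suc J ] χ (j <? Q) * (+ 2 * + j + 1ℤ)                       ≡⟨ ∑-last J _ ⟩
    (∑[ j < J ] χ (j <? Q) * (+ 2 * + j + 1ℤ)) + χ (J <? Q) * (+ 2 * + J + 1ℤ)
      ≡⟨ cong₂ (λ s c → s + c * (+ 2 * + J + 1ℤ)) (∑-odd J Q) (χ-no (J <? Q) J≮Q) ⟩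
    + (J ⊓ Q) * + (J ⊓ Q) + 0ℤ * (+ 2 * + J + 1ℤ)                        ≡⟨ ℤ.+-identityʳ _ ⟩
    + (J ⊓ Q) * + (J ⊓ Q)                                                ≡⟨ cong (λ m → + m * + m) (trans (ℕ.m≥n⇒m⊓n≡n Q≤J) (sym (ℕ.m≥n⇒m⊓n≡n (ℕ.m≤n⇒m≤1+n Q≤J)))) ⟩
    + (suc J ⊓ Q) * + (suc J ⊓ Q)                                        ∎
    where
    Q≤J = ℕ.≮⇒≥ J≮Q

  floorSum weightedFloorSum floorSquareSum : (h k : ℕ) .{{_ : NonZero k}} → ℤ
  floorSum         h k = ∑[ m < k ] + ((h ℕ.* m) / k)
  weightedFloorSum h k = ∑[ m < k ] + m * + ((h ℕ.* m) / k)
  floorSquareSum   h k = ∑[ m < k ] + ((h ℕ.* m) / k) * + ((h ℕ.* m) / k)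

  a≤n/d⇒a*d≤n : ∀ a n d .{{_ : NonZero d}} → a ≤ n / d → a ℕ.* d ≤ n
  a≤n/d⇒a*d≤n a n d a≤n/d = ℕ.≤-trans (ℕ.*-monoˡ-≤ d a≤n/d) (m/n*n≤m n d)

  a*d≤n⇒a≤n/d : ∀ a n d .{{_ : NonZero d}} → a ℕ.* d ≤ n → a ≤ n / d
  a*d≤n⇒a≤n/d a n d a*d≤n = subst (_≤ n / d) (m*n/n≡m a d) (/-monoˡ-≤ d a*d≤n)

  residue-≢0 : ∀ h k .{{_ : NonZero k}} → Coprime h k → ∀ m → 0 < m → m < k → (h ℕ.* m) % k ≢ 0
  residue-≢0 h k h⊥k m 0<m m<k hm%k≡0 =
    ℕ.<⇒≱ m<k (∣⇒≤ {{ℕ.>-nonZero 0<m}} (coprime-divisor (Coprime.sym h⊥k) (m%n≡0⇒n∣m (h ℕ.* m) k hm%k≡0)))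

  dedekindℤ-expand : ∀ h k .{{_ : NonZero k}} → Coprime h k →
    dedekindℤ h k ≡ (∑[ m < k ] (+ 2 * + ((h ℕ.* m) % k) - + k) * (+ 2 * + m - + k)) - + k * + k
  dedekindℤ-expand h k@(suc k₋₁) h⊥k = begin
    sawNum k (r 0) * sawNum k 0 + (∑[ m < k₋₁ ] sawNum k (r (suc m)) * sawNum k (suc m % k))
      ≡⟨ cong₂ _+_ (cong (λ x → sawNum k (x % k) * sawNum k 0) (ℕ.*-zeroʳ h)) (∑-cong k₋₁ nonzero-terms) ⟩
    0ℤ + S                                     ≡⟨ add-square S (+ k) ⟩
    (+ k * + k + S) - + k * + k                ≡⟨ cong (λ x → (x + S) - + k * + k) zero-term ⟨
    (G 0 + S) - + k * + k                      ∎
    where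
    r : ℕ → ℕ
    r m = (h ℕ.* m) % k
    G : ℕ → ℤ
    G m = (+ 2 * + r m - + k) * (+ 2 * + m - + k)
    S = ∑[ m < k₋₁ ] G (suc m)
    nonzero-terms : ∀ m → m < k₋₁ → sawNum k (r (suc m)) * sawNum k (suc m % k) ≡ G (suc m)
    nonzero-terms m m<k₋₁ = cong₂ _*_ (sawNum-≢0 k (r (suc m)) (residue-≢0 h k h⊥k (suc m) z<s (s<s m<k₋₁)))
                                      (cong (sawNum k) (m<n⇒m%n≡m (s<s m<k₋₁)))
    zero-term : G 0 ≡ + k * + k
    zero-term = trans (cong (λ x → (+ 2 * + (x % k) - + k) * (+ 2 * + 0 - + k)) (ℕ.*-zeroʳ h)) (square (+ k))
      where
      square : ∀ x → (+ 2 * 0ℤ - x) * (+ 2 * 0ℤ - x) ≡ x * x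
      square = solve-∀
    add-square : ∀ s x → 0ℤ + s ≡ (x * x + s) - x * x
    add-square = solve-∀

  module Floors (h k : ℕ) .{{_ : NonZero k}} (h⊥k : Coprime h k) where

    q r : ℕ → ℕ
    q m = (h ℕ.* m) / k
    r m = (h ℕ.* m) % k

    S₁ S₂ : ℤ
    S₁ = ∑[ m < k ] + m
    S₂ = ∑[ m < k ] + m * + m

    residue : ∀ m → + r m ≡ + h * + m - + k * + q m
    residue m = begin
      + r m                           ≡⟨ add-sub (+ r m) (+ k * + q m) ⟩
      (+ r m + + k * + q m) - + k * + q m ≡⟨ cong (_- + k * + q m) r+kq≡hm ⟩
      + h * + m - + k * + q m         ∎
      where
      add-sub : ∀ x y → x ≡ (x + y) - y
      add-sub = solve-∀
      r+kq≡hm : + r m + + k * + q m ≡ + h * + m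
      r+kq≡hm = begin
        + r m + + k * + q m       ≡⟨ cong (_+_ (+ r m)) (trans (sym (ℤ.pos-* k (q m))) (cong +_ (ℕ.*-comm k (q m)))) ⟩
        + r m + + (q m ℕ.* k)     ≡⟨ ℤ.pos-+ (r m) (q m ℕ.* k) ⟨
        + (r m ℕ.+ q m ℕ.* k)     ≡⟨ cong +_ (m≡m%n+[m/n]*n (h ℕ.* m) k) ⟨
        + (h ℕ.* m)               ≡⟨ ℤ.pos-* h m ⟩
        + h * + m                 ∎

    ∑-residue : ∑[ m < k ] + r m ≡ S₁
    ∑-residue = ∑-*-%-permute h k (Coprime.sym h⊥k) (λ x → + x)

    ∑-residue² : ∑[ m < k ] + r m * + r m ≡ S₂
    ∑-residue² = ∑-*-%-permute h k (Coprime.sym h⊥k) (λ x → + x * + x)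

    C A B : ℤ
    C = floorSum h k
    A = weightedFloorSum h k
    B = floorSquareSum h k

    ∑-residue-linear : + h * S₁ + (- + k) * C ≡ S₁
    ∑-residue-linear = sym (begin
      S₁                                              ≡⟨ ∑-residue ⟨
      ∑[ m < k ] + r m                                ≡⟨ ∑-cong k (λ m _ → trans (residue m) (cong (_+_ (+ h * + m)) (ℤ.neg-distribˡ-* (+ k) (+ q m)))) ⟩
      ∑[ m < k ] (+ h * + m + (- + k) * + q m)        ≡⟨ ∑-linear₂ k (+ h) (- + k) (λ m → + m) (λ m → + q m) ⟩
      + h * S₁ + (- + k) * C                          ∎)

    floorSum-closed : + 2 * floorSum h k ≡ (+ h - 1ℤ) * (+ k - 1ℤ)
    floorSum-closed = ℤ.*-cancelˡ-≡ (+ k) (+ 2 * C) ((+ h - 1ℤ) * (+ k - 1ℤ)) (begin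
      + k * (+ 2 * C)                                                 ≡⟨ rearrange (+ h) (+ k) S₁ C ⟩
      (+ h - 1ℤ) * (+ 2 * S₁) - + 2 * (+ h * S₁ + (- + k) * C - S₁)   ≡⟨ cong₂ (λ x y → (+ h - 1ℤ) * x - + 2 * (y - S₁)) (∑-id k) ∑-residue-linear ⟩
      (+ h - 1ℤ) * (+ k * (+ k - 1ℤ)) - + 2 * (S₁ - S₁)               ≡⟨ conclude (+ h) (+ k) S₁ ⟩
      + k * ((+ h - 1ℤ) * (+ k - 1ℤ))                                 ∎)
      where
      rearrange : ∀ h k s c → k * (+ 2 * c) ≡ (h - 1ℤ) * (+ 2 * s) - + 2 * (h * s + (- k) * c - s)
      rearrange = solve-∀
      conclude : ∀ h k s → (h - 1ℤ) * (k * (k - 1ℤ)) - + 2 * (s - s) ≡ k * ((h - 1ℤ) * (k - 1ℤ))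
      conclude = solve-∀

    ∑-residue-square : + h * + h * S₂ + (- (+ 2 * + h * + k)) * A + + k * + k * B ≡ S₂
    ∑-residue-square = sym (begin
      S₂                                  ≡⟨ ∑-residue² ⟨
      ∑[ m < k ] + r m * + r m            ≡⟨ ∑-cong k (λ m _ → trans (cong₂ _*_ (residue m) (residue m)) (expand (+ h) (+ k) (+ m) (+ q m))) ⟩
      ∑[ m < k ] (+ h * + h * (+ m * + m) + (- (+ 2 * + h * + k)) * (+ m * + q m) + + k * + k * (+ q m * + q m))
                                          ≡⟨ ∑-linear₃ k (+ h * + h) (- (+ 2 * + h * + k)) (+ k * + k) (λ m → + m * + m) (λ m → + m * + q m) (λ m → + q m * + q m) ⟩
      + h * + h * S₂ + (- (+ 2 * + h * + k)) * A + + k * + k * B ∎)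
      where
      expand : ∀ h k m q → (h * m - k * q) * (h * m - k * q) ≡ h * h * (m * m) + (- (+ 2 * h * k)) * (m * q) + k * k * (q * q)
      expand = solve-∀

    ∑-residue-id : ∑[ m < k ] + r m * + m ≡ + h * S₂ + (- + k) * A
    ∑-residue-id = begin
      ∑[ m < k ] + r m * + m                      ≡⟨ ∑-cong k (λ m _ → trans (cong (_* + m) (residue m)) (expand (+ h) (+ k) (+ m) (+ q m))) ⟩
      ∑[ m < k ] (+ h * (+ m * + m) + (- + k) * (+ m * + q m)) ≡⟨ ∑-linear₂ k (+ h) (- + k) (λ m → + m * + m) (λ m → + m * + q m) ⟩
      + h * S₂ + (- + k) * A                      ∎
      where
      expand : ∀ h k m q → (h * m - k * q) * m ≡ h * (m * m) + (- k) * (m * q)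
      expand = solve-∀

    ∑-sawtooth-product : (∑[ m < k ] (+ 2 * + r m - + k) * (+ 2 * + m - + k))
                         ≡ + 4 * (+ h * S₂ + (- + k) * A) + (- (+ 2 * + k)) * (S₁ + S₁) + + k * + k * (1ℤ * + k)
    ∑-sawtooth-product = begin
      ∑[ m < k ] (+ 2 * + r m - + k) * (+ 2 * + m - + k)
        ≡⟨ ∑-cong k (λ m _ → expand (+ k) (+ r m) (+ m)) ⟩
      ∑[ m < k ] (+ 4 * (+ r m * + m) + (- (+ 2 * + k)) * (+ r m + + m) + + k * + k * 1ℤ)
        ≡⟨ ∑-linear₃ k (+ 4) (- (+ 2 * + k)) (+ k * + k) (λ m → + r m * + m) (λ m → + r m + + m) (λ _ → 1ℤ) ⟩
      + 4 * (∑[ m < k ] + r m * + m) + (- (+ 2 * + k)) * (∑[ m < k ] (+ r m + + m)) + + k * + k * (∑[ _ < k ] 1ℤ)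
        ≡⟨ cong₂ (λ x y → + 4 * x + (- (+ 2 * + k)) * y + + k * + k * (∑[ _ < k ] 1ℤ)) ∑-residue-id
                 (trans (∑-distrib-+ k (λ m → + r m) (λ m → + m)) (cong (_+ S₁) ∑-residue)) ⟩
      + 4 * (+ h * S₂ + (- + k) * A) + (- (+ 2 * + k)) * (S₁ + S₁) + + k * + k * (∑[ _ < k ] 1ℤ)
        ≡⟨ cong (λ x → + 4 * (+ h * S₂ + (- + k) * A) + (- (+ 2 * + k)) * (S₁ + S₁) + + k * + k * x) (∑-const k 1ℤ) ⟩
      + 4 * (+ h * S₂ + (- + k) * A) + (- (+ 2 * + k)) * (S₁ + S₁) + + k * + k * (1ℤ * + k) ∎
      where
      expand : ∀ k r m → (+ 2 * r - k) * (+ 2 * m - k) ≡ + 4 * (r * m) + (- (+ 2 * k)) * (r + m) + k * k * 1ℤ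
      expand = solve-∀

    dedekindℤ-via-weightedFloorSum :
      + 3 * dedekindℤ h k ≡ + 2 * + h * + k * (+ k - 1ℤ) * (+ 2 * + k - 1ℤ) - + 12 * + k * A - + 3 * + k * + k * + k + + 3 * + k * + k
    dedekindℤ-via-weightedFloorSum = begin
      + 3 * dedekindℤ h k
        ≡⟨ cong (+ 3 *_) (dedekindℤ-expand h k h⊥k) ⟩
      + 3 * ((∑[ m < k ] (+ 2 * + r m - + k) * (+ 2 * + m - + k)) - + k * + k)
        ≡⟨ cong (λ x → + 3 * (x - + k * + k)) ∑-sawtooth-product ⟩
      + 3 * (+ 4 * (+ h * S₂ + (- + k) * A) + (- (+ 2 * + k)) * (S₁ + S₁) + + k * + k * (1ℤ * + k) - + k * + k)
        ≡⟨ rearrange (+ h) (+ k) A S₁ S₂ ⟩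
      + 2 * + h * (+ 6 * S₂) - + 12 * + k * A - + 6 * + k * (+ 2 * S₁) + + 3 * + k * + k * + k - + 3 * + k * + k
        ≡⟨ cong₂ (λ x y → + 2 * + h * x - + 12 * + k * A - + 6 * + k * y + + 3 * + k * + k * + k - + 3 * + k * + k) (∑-square k) (∑-id k) ⟩
      + 2 * + h * (+ k * (+ k - 1ℤ) * (+ 2 * + k - 1ℤ)) - + 12 * + k * A - + 6 * + k * (+ k * (+ k - 1ℤ)) + + 3 * + k * + k * + k - + 3 * + k * + k
        ≡⟨ conclude (+ h) (+ k) A ⟩
      + 2 * + h * + k * (+ k - 1ℤ) * (+ 2 * + k - 1ℤ) - + 12 * + k * A - + 3 * + k * + k * + k + + 3 * + k * + k ∎
      where
      rearrange : ∀ h k a s₁ s₂ →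
        + 3 * (+ 4 * (h * s₂ + (- k) * a) + (- (+ 2 * k)) * (s₁ + s₁) + k * k * (1ℤ * k) - k * k)
        ≡ + 2 * h * (+ 6 * s₂) - + 12 * k * a - + 6 * k * (+ 2 * s₁) + + 3 * k * k * k - + 3 * k * k
      rearrange = solve-∀
      conclude : ∀ h k a →
        + 2 * h * (k * (k - 1ℤ) * (+ 2 * k - 1ℤ)) - + 12 * k * a - + 6 * k * (k * (k - 1ℤ)) + + 3 * k * k * k - + 3 * k * k
        ≡ + 2 * h * k * (k - 1ℤ) * (+ 2 * k - 1ℤ) - + 12 * k * a - + 3 * k * k * k + + 3 * k * k
      conclude = solve-∀

  module Lattice (h k : ℕ) .{{_ : NonZero h}} .{{_ : NonZero k}} (h⊥k : Coprime h k) where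

    q q′ : ℕ → ℕ
    q  m = (h ℕ.* m) / k
    q′ j = (k ℕ.* j) / h

    q<h : ∀ {m} → m < k → q m < h
    q<h m<k = m<n*o⇒m/o<n (ℕ.*-monoʳ-< h m<k)

    q′<k : ∀ {j} → j < h → q′ j < k
    q′<k j<h = m<n*o⇒m/o<n (ℕ.*-monoʳ-< k j<h)

    hm≢[1+j]k : ∀ m j → suc j < h → h ℕ.* m ≢ suc j ℕ.* k
    hm≢[1+j]k m j 1+j<h hm≡[1+j]k = ℕ.<⇒≱ 1+j<h (∣⇒≤ (coprime-divisor h⊥k (divides m k[1+j]≡mh)))
      where
      k[1+j]≡mh : k ℕ.* suc j ≡ m ℕ.* h
      k[1+j]≡mh = trans (ℕ.*-comm k (suc j)) (trans (sym hm≡[1+j]k) (ℕ.*-comm h m))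

    q≤⇒≤q′ : ∀ m j → q m ≤ j → m ≤ q′ (suc j)
    q≤⇒≤q′ m j qm≤j = a*d≤n⇒a≤n/d m (k ℕ.* suc j) h (subst₂ _≤_ (ℕ.*-comm h m) (ℕ.*-comm (suc j) k) (ℕ.<⇒≤ hm<[1+j]k))
      where
      hm<[1+j]k : h ℕ.* m < suc j ℕ.* k
      hm<[1+j]k = ℕ.≰⇒> (λ [1+j]k≤hm → ℕ.<⇒≱ (s≤s qm≤j) (a*d≤n⇒a≤n/d (suc j) (h ℕ.* m) k [1+j]k≤hm))

    ≤q′⇒q≤ : ∀ m j → suc j < h → m ≤ q′ (suc j) → q m ≤ j
    ≤q′⇒q≤ m j 1+j<h m≤q′ = ℕ.s≤s⁻¹ (ℕ.≰⇒> (λ 1+j≤qm → ℕ.<⇒≱ hm<[1+j]k (a≤n/d⇒a*d≤n (suc j) (h ℕ.* m) k 1+j≤qm)))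
      where
      hm≤[1+j]k : h ℕ.* m ≤ suc j ℕ.* k
      hm≤[1+j]k = subst₂ _≤_ (ℕ.*-comm m h) (ℕ.*-comm k (suc j)) (a≤n/d⇒a*d≤n m (k ℕ.* suc j) h m≤q′)
      hm<[1+j]k : h ℕ.* m < suc j ℕ.* k
      hm<[1+j]k = ℕ.≤∧≢⇒< hm≤[1+j]k (hm≢[1+j]k m j 1+j<h)

    χ-floor-swap : ∀ m j → suc j < h → χ (q m ≤? j) ≡ χ (m ≤? q′ (suc j))
    χ-floor-swap m j 1+j<h with q m ≤? j | m ≤? q′ (suc j)
    ... | yes _    | yes _     = refl
    ... | no  _    | no  _     = refl
    ... | yes qm≤j | no  m≰q′  = contradiction (q≤⇒≤q′ m j qm≤j) m≰q′
    ... | no  qm≰j | yes m≤q′  = contradiction (≤q′⇒q≤ m j 1+j<h m≤q′) qm≰j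

    count : ℕ → ℤ
    count j = ∑[ m < k ] χ (j <? q m)

    count-below-top : ∀ j → suc j < h → count j ≡ + k - + suc (q′ (suc j))
    count-below-top j 1+j<h = begin
      ∑[ m < k ] χ (j <? q m)                       ≡⟨ ∑-cong k (λ m _ → χ-< j (q m)) ⟩
      ∑[ m < k ] (1ℤ - χ (q m ≤? j))                 ≡⟨ ∑-distrib-sub k (λ _ → 1ℤ) (λ m → χ (q m ≤? j)) ⟩
      (∑[ _ < k ] 1ℤ) - (∑[ m < k ] χ (q m ≤? j))    ≡⟨ cong₂ _-_ (trans (∑-const k 1ℤ) (ℤ.*-identityˡ (+ k))) (∑-cong k (λ m _ → χ-floor-swap m j 1+j<h)) ⟩
      + k - (∑[ m < k ] χ (m ≤? q′ (suc j)))         ≡⟨ cong (_-_ (+ k)) (∑-count-≤ k (q′ (suc j)) (q′<k 1+j<h)) ⟩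
      + k - + suc (q′ (suc j))                       ∎

    count-top : ∀ j → suc j ≡ h → count j ≡ 0ℤ
    count-top j 1+j≡h = ∑-zero k (λ m m<k → χ-no (j <? q m) (λ j<qm → ℕ.<⇒≱ (q<h m<k) (subst (_≤ q m) 1+j≡h j<qm)))

    g : ℕ → ℤ
    g j = (+ 2 * + j - 1ℤ) * (+ k - 1ℤ - + q′ j)

      -- Write ⌊hm/k⌋² as Σ_{j < ⌊hm/k⌋} (2j + 1) and exchange the sums: for j + 1 < h the m < k with
    -- ⌊hm/k⌋ > j are exactly those with m > ⌊k(j + 1)/h⌋, since hm = (j + 1)k is impossible.
    floorSquareSum-count : floorSquareSum h k ≡ (∑ h g) + (+ k - 1ℤ)
    floorSquareSum-count = begin
      ∑[ m < k ] + q m * + q m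
        ≡⟨ ∑-cong k (λ m m<k → sym (trans (∑-odd h (q m)) (cong (λ x → + x * + x) (ℕ.m≥n⇒m⊓n≡n (ℕ.<⇒≤ (q<h m<k)))))) ⟩
      ∑[ m < k ] ∑[ j < h ] χ (j <? q m) * (+ 2 * + j + 1ℤ)
        ≡⟨ ∑-comm k h (λ m j → χ (j <? q m) * (+ 2 * + j + 1ℤ)) ⟩
      ∑[ j < h ] ∑[ m < k ] χ (j <? q m) * (+ 2 * + j + 1ℤ)
        ≡⟨ ∑-cong h (λ j _ → trans (∑-cong k (λ m _ → ℤ.*-comm (χ (j <? q m)) (+ 2 * + j + 1ℤ))) (sym (*-distribˡ-∑ k (+ 2 * + j + 1ℤ) (λ m → χ (j <? q m))))) ⟩
      ∑ h F
        ≡⟨ cong (λ n → ∑ n F) (sym (ℕ.suc-pred h)) ⟩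
      ∑ (suc h₋₁) F
        ≡⟨ ∑-last h₋₁ F ⟩
      ∑ h₋₁ F + F h₋₁
        ≡⟨ cong₂ _+_ (∑-cong h₋₁ below-top) (trans (cong (_*_ (+ 2 * + h₋₁ + 1ℤ)) (count-top h₋₁ (ℕ.suc-pred h))) (ℤ.*-zeroʳ (+ 2 * + h₋₁ + 1ℤ))) ⟩
      (∑[ j < h₋₁ ] g (suc j)) + 0ℤ
        ≡⟨ first-term (∑[ j < h₋₁ ] g (suc j)) (+ k) ⟩
      ((+ 2 * + 0 - 1ℤ) * (+ k - 1ℤ - + 0) + (∑[ j < h₋₁ ] g (suc j))) + (+ k - 1ℤ)
        ≡⟨ cong (λ x → ((+ 2 * + 0 - 1ℤ) * (+ k - 1ℤ - + x) + (∑[ j < h₋₁ ] g (suc j))) + (+ k - 1ℤ)) q′0 ⟨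
      ∑ (suc h₋₁) g + (+ k - 1ℤ)
        ≡⟨ cong (λ n → ∑ n g + (+ k - 1ℤ)) (ℕ.suc-pred h) ⟩
      ∑ h g + (+ k - 1ℤ) ∎
      where
      h₋₁ = ℕ.pred h
      F : ℕ → ℤ
      F j = (+ 2 * + j + 1ℤ) * count j
      q′0 : q′ 0 ≡ 0
      q′0 = trans (cong (_/ h) (ℕ.*-zeroʳ k)) (0/n≡0 h)
      below-top : ∀ j → j < h₋₁ → F j ≡ g (suc j)
      below-top j j<h₋₁ = trans (cong (_*_ (+ 2 * + j + 1ℤ)) (count-below-top j 1+j<h)) (shift (+ j) (+ k) (+ q′ (suc j)))
        where
        1+j<h : suc j < h
        1+j<h = subst (suc j <_) (ℕ.suc-pred h) (s<s j<h₋₁)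
        shift : ∀ j k x → (+ 2 * j + 1ℤ) * (k - (1ℤ + x)) ≡ (+ 2 * (1ℤ + j) - 1ℤ) * (k - 1ℤ - x)
        shift = solve-∀
      first-term : ∀ s k → s + 0ℤ ≡ ((+ 2 * 0ℤ - 1ℤ) * (k - 1ℤ - 0ℤ) + s) + (k - 1ℤ)
      first-term = solve-∀

    floorSquareSum-lattice :
      + 2 * floorSquareSum h k ≡ (+ h - 1ℤ) * (+ k - 1ℤ) * (+ 2 * + h - 1ℤ) - + 4 * weightedFloorSum k h
    floorSquareSum-lattice = begin
      + 2 * floorSquareSum h k
        ≡⟨ cong (+ 2 *_) floorSquareSum-count ⟩
      + 2 * (∑ h g + (+ k - 1ℤ))
        ≡⟨ cong (λ x → + 2 * (x + (+ k - 1ℤ))) ∑-g ⟩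
      + 2 * (+ 2 * (+ k - 1ℤ) * T₁ + (- + 2) * A′ + 1ℤ * C′ + (- (+ k - 1ℤ)) * + h + (+ k - 1ℤ))
        ≡⟨ rearrange (+ h) (+ k) T₁ A′ C′ ⟩
      + 2 * (+ k - 1ℤ) * (+ 2 * T₁) - + 4 * A′ + + 2 * C′ - + 2 * (+ k - 1ℤ) * + h + + 2 * (+ k - 1ℤ)
        ≡⟨ cong₂ (λ x y → + 2 * (+ k - 1ℤ) * x - + 4 * A′ + y - + 2 * (+ k - 1ℤ) * + h + + 2 * (+ k - 1ℤ))
                 (∑-id h) (Floors.floorSum-closed k h (Coprime.sym h⊥k)) ⟩
      + 2 * (+ k - 1ℤ) * (+ h * (+ h - 1ℤ)) - + 4 * A′ + (+ k - 1ℤ) * (+ h - 1ℤ) - + 2 * (+ k - 1ℤ) * + h + + 2 * (+ k - 1ℤ)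
        ≡⟨ conclude (+ h) (+ k) A′ ⟩
      (+ h - 1ℤ) * (+ k - 1ℤ) * (+ 2 * + h - 1ℤ) - + 4 * A′ ∎
      where
      T₁ = ∑[ j < h ] + j
      A′ = weightedFloorSum k h
      C′ = floorSum k h
      ∑-g : ∑ h g ≡ + 2 * (+ k - 1ℤ) * T₁ + (- + 2) * A′ + 1ℤ * C′ + (- (+ k - 1ℤ)) * + h
      ∑-g = begin
        ∑ h g
          ≡⟨ ∑-cong h (λ j _ → expand (+ k) (+ j) (+ q′ j)) ⟩
        ∑[ j < h ] ((+ 2 * (+ k - 1ℤ) * + j + (- + 2) * (+ j * + q′ j) + 1ℤ * + q′ j) + (- (+ k - 1ℤ)))
          ≡⟨ ∑-distrib-+ h _ (λ _ → - (+ k - 1ℤ)) ⟩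
        (∑[ j < h ] (+ 2 * (+ k - 1ℤ) * + j + (- + 2) * (+ j * + q′ j) + 1ℤ * + q′ j)) + (∑[ _ < h ] - (+ k - 1ℤ))
          ≡⟨ cong₂ _+_ (∑-linear₃ h (+ 2 * (+ k - 1ℤ)) (- + 2) 1ℤ (λ j → + j) (λ j → + j * + q′ j) (λ j → + q′ j)) (∑-const h (- (+ k - 1ℤ))) ⟩
        + 2 * (+ k - 1ℤ) * T₁ + (- + 2) * A′ + 1ℤ * C′ + (- (+ k - 1ℤ)) * + h ∎
        where
        expand : ∀ k j x → (+ 2 * j - 1ℤ) * (k - 1ℤ - x) ≡ (+ 2 * (k - 1ℤ) * j + (- + 2) * (j * x) + 1ℤ * x) + (- (k - 1ℤ))
        expand = solve-∀
      rearrange : ∀ h k t a c →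
        + 2 * (+ 2 * (k - 1ℤ) * t + (- + 2) * a + 1ℤ * c + (- (k - 1ℤ)) * h + (k - 1ℤ))
        ≡ + 2 * (k - 1ℤ) * (+ 2 * t) - + 4 * a + + 2 * c - + 2 * (k - 1ℤ) * h + + 2 * (k - 1ℤ)
      rearrange = solve-∀
      conclude : ∀ h k a →
        + 2 * (k - 1ℤ) * (h * (h - 1ℤ)) - + 4 * a + (k - 1ℤ) * (h - 1ℤ) - + 2 * (k - 1ℤ) * h + + 2 * (k - 1ℤ)
        ≡ (h - 1ℤ) * (k - 1ℤ) * (+ 2 * h - 1ℤ) - + 4 * a
      conclude = solve-∀

  weightedFloorSum-reciprocity : ∀ h k .{{_ : NonZero h}} .{{_ : NonZero k}} → Coprime h k →
    + 12 * + h * weightedFloorSum h k + + 12 * + k * weightedFloorSum k h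
    ≡ (+ h - 1ℤ) * (+ k - 1ℤ) * (+ 8 * + h * + k - + h - + k - 1ℤ)
  weightedFloorSum-reciprocity h k h⊥k = ℤ.*-cancelˡ-≡ (+ k) _ _ (begin
    + k * (+ 12 * + h * A + + 12 * + k * A′)
      ≡⟨ rearrange (+ h) (+ k) A A′ S₂ B ⟩
    + h * + h * (+ 6 * S₂) + + 3 * + k * + k * (+ 2 * B + + 4 * A′) - + 6 * (+ h * + h * S₂ + (- (+ 2 * + h * + k)) * A + + k * + k * B)
      ≡⟨ cong (λ x → + h * + h * (+ 6 * S₂) + + 3 * + k * + k * (+ 2 * B + + 4 * A′) - + 6 * x) ∑-residue-square ⟩
    + h * + h * (+ 6 * S₂) + + 3 * + k * + k * (+ 2 * B + + 4 * A′) - + 6 * S₂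
      ≡⟨ cong₂ (λ x y → + h * + h * x + + 3 * + k * + k * y - x) (∑-square k) lattice ⟩
    + h * + h * (+ k * (+ k - 1ℤ) * (+ 2 * + k - 1ℤ)) + + 3 * + k * + k * ((+ h - 1ℤ) * (+ k - 1ℤ) * (+ 2 * + h - 1ℤ)) - + k * (+ k - 1ℤ) * (+ 2 * + k - 1ℤ)
      ≡⟨ conclude (+ h) (+ k) ⟩
    + k * ((+ h - 1ℤ) * (+ k - 1ℤ) * (+ 8 * + h * + k - + h - + k - 1ℤ)) ∎)
    where
    open Floors h k h⊥k using (S₂; A; B; ∑-residue-square)
    A′ = weightedFloorSum k h
    lattice : + 2 * B + + 4 * A′ ≡ (+ h - 1ℤ) * (+ k - 1ℤ) * (+ 2 * + h - 1ℤ)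
    lattice = trans (cong (_+ + 4 * A′) (Lattice.floorSquareSum-lattice h k h⊥k)) (sub-add _ (+ 4 * A′))
      where
      sub-add : ∀ x y → x - y + y ≡ x
      sub-add = solve-∀
    rearrange : ∀ h k a a′ s b →
      k * (+ 12 * h * a + + 12 * k * a′)
      ≡ h * h * (+ 6 * s) + + 3 * k * k * (+ 2 * b + + 4 * a′) - + 6 * (h * h * s + (- (+ 2 * h * k)) * a + k * k * b)
    rearrange = solve-∀
    conclude : ∀ h k →
      h * h * (k * (k - 1ℤ) * (+ 2 * k - 1ℤ)) + + 3 * k * k * ((h - 1ℤ) * (k - 1ℤ) * (+ 2 * h - 1ℤ)) - k * (k - 1ℤ) * (+ 2 * k - 1ℤ)
      ≡ k * ((h - 1ℤ) * (k - 1ℤ) * (+ 8 * h * k - h - k - 1ℤ))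
    conclude = solve-∀

  dedekindℤ-reciprocity : ∀ h k .{{_ : NonZero h}} .{{_ : NonZero k}} → Coprime h k →
    + 3 * + h * + h * dedekindℤ h k + + 3 * + k * + k * dedekindℤ k h
    ≡ + h * + k * (+ h * + h + + k * + k + 1ℤ) - + 3 * + h * + h * + k * + k
  dedekindℤ-reciprocity h k h⊥k = begin
    + 3 * + h * + h * dedekindℤ h k + + 3 * + k * + k * dedekindℤ k h
      ≡⟨ regroup (+ h) (+ k) (dedekindℤ h k) (dedekindℤ k h) ⟩
    + h * + h * (+ 3 * dedekindℤ h k) + + k * + k * (+ 3 * dedekindℤ k h)
      ≡⟨ cong₂ (λ x y → + h * + h * x + + k * + k * y)
               (Floors.dedekindℤ-via-weightedFloorSum h k h⊥k)
               (Floors.dedekindℤ-via-weightedFloorSum k h (Coprime.sym h⊥k)) ⟩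
    + h * + h * (+ 2 * + h * + k * (+ k - 1ℤ) * (+ 2 * + k - 1ℤ) - + 12 * + k * A - + 3 * + k * + k * + k + + 3 * + k * + k)
      + + k * + k * (+ 2 * + k * + h * (+ h - 1ℤ) * (+ 2 * + h - 1ℤ) - + 12 * + h * A′ - + 3 * + h * + h * + h + + 3 * + h * + h)
      ≡⟨ rearrange (+ h) (+ k) A A′ ⟩
    P - + h * + k * (+ 12 * + h * A + + 12 * + k * A′)
      ≡⟨ cong (λ x → P - + h * + k * x) (weightedFloorSum-reciprocity h k h⊥k) ⟩
    P - + h * + k * ((+ h - 1ℤ) * (+ k - 1ℤ) * (+ 8 * + h * + k - + h - + k - 1ℤ))
      ≡⟨ conclude (+ h) (+ k) ⟩
    + h * + k * (+ h * + h + + k * + k + 1ℤ) - + 3 * + h * + h * + k * + k ∎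
    where
    A  = weightedFloorSum h k
    A′ = weightedFloorSum k h
    P : ℤ
    P = + h * + h * (+ 2 * + h * + k * (+ k - 1ℤ) * (+ 2 * + k - 1ℤ) - + 3 * + k * + k * + k + + 3 * + k * + k)
      + + k * + k * (+ 2 * + k * + h * (+ h - 1ℤ) * (+ 2 * + h - 1ℤ) - + 3 * + h * + h * + h + + 3 * + h * + h)
    regroup : ∀ h k e e′ → + 3 * h * h * e + + 3 * k * k * e′ ≡ h * h * (+ 3 * e) + k * k * (+ 3 * e′)
    regroup = solve-∀
    rearrange : ∀ h k a a′ →
      h * h * (+ 2 * h * k * (k - 1ℤ) * (+ 2 * k - 1ℤ) - + 12 * k * a - + 3 * k * k * k + + 3 * k * k)
        + k * k * (+ 2 * k * h * (h - 1ℤ) * (+ 2 * h - 1ℤ) - + 12 * h * a′ - + 3 * h * h * h + + 3 * h * h)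
      ≡ (h * h * (+ 2 * h * k * (k - 1ℤ) * (+ 2 * k - 1ℤ) - + 3 * k * k * k + + 3 * k * k)
           + k * k * (+ 2 * k * h * (h - 1ℤ) * (+ 2 * h - 1ℤ) - + 3 * h * h * h + + 3 * h * h))
        - h * k * (+ 12 * h * a + + 12 * k * a′)
    rearrange = solve-∀
    conclude : ∀ h k →
      (h * h * (+ 2 * h * k * (k - 1ℤ) * (+ 2 * k - 1ℤ) - + 3 * k * k * k + + 3 * k * k)
           + k * k * (+ 2 * k * h * (h - 1ℤ) * (+ 2 * h - 1ℤ) - + 3 * h * h * h + + 3 * h * h))
        - h * k * ((h - 1ℤ) * (k - 1ℤ) * (+ 8 * h * k - h - k - 1ℤ))
      ≡ h * k * (h * h + k * k + 1ℤ) - + 3 * h * h * k * k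
    conclude = solve-∀

module Difference where

  open import Data.Nat.Base as ℕ using (ℕ; suc; NonZero)
  import Data.Nat.Properties as ℕ
  open import Data.Nat.DivMod using (_%_; [m+kn]%n≡m%n)
  open import Data.Nat.Coprimality as Coprime using (Coprime)
  open import Data.Nat.Divisibility using (_∣_; ∣m+n∣m⇒∣n; ∣n⇒∣m*n)
  open import Data.Product.Base using (_,_)
  open import Data.Nat.Tactic.RingSolver as ℕ-Solver using ()
  open import Data.Integer.Base as ℤ using (ℤ; +_; 1ℤ)
  import Data.Integer.Properties as ℤ
  open import Data.Integer.Tactic.RingSolver using (solve-∀)
  open import Relation.Binary.PropositionalEquality
    using (_≡_; refl; sym; trans; cong; cong₂; subst; module ≡-Reasoning)
  open ≡-Reasoning
  open import Data.Rational.Base using (_-_)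
  open import Defs using (dedekind; _÷_)
  open RangeSum
  open Fraction
  open Sawtooth
  open Reciprocity

  dedekindℤ-periodic : ∀ h t k .{{_ : NonZero k}} → dedekindℤ (h ℕ.+ t ℕ.* k) k ≡ dedekindℤ h k
  dedekindℤ-periodic h t k = ∑-cong k (λ m _ → cong (λ r → sawNum k r ℤ.* sawNum k (m % k)) (shift m))
    where
    shift : ∀ m → ((h ℕ.+ t ℕ.* k) ℕ.* m) % k ≡ (h ℕ.* m) % k
    shift m = trans (cong (_% k) (distrib h t k m)) ([m+kn]%n≡m%n (h ℕ.* m) (t ℕ.* m) k)
      where
      distrib : ∀ h t k m → (h ℕ.+ t ℕ.* k) ℕ.* m ≡ h ℕ.* m ℕ.+ t ℕ.* m ℕ.* k
      distrib = ℕ-Solver.solve-∀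

  coprime-shift : ∀ a t d → Coprime a d → Coprime (a ℕ.+ t ℕ.* d) d
  coprime-shift a t d a⊥d {i} (i∣a+td , i∣d) =
    a⊥d (∣m+n∣m⇒∣n (subst (i ∣_) (ℕ.+-comm a (t ℕ.* d)) i∣a+td) (∣n⇒∣m*n t i∣d) , i∣d)

  -- The reciprocity laws for (d, a) and (d, b) share s(a,d) = s(b,d), which cancels.
  dedekindℤ-shift-difference : ∀ d a b m .{{_ : NonZero d}} .{{_ : NonZero a}} .{{_ : NonZero b}} →
    b ≡ a ℕ.+ m ℕ.* d → Coprime a d →
    + 3 ℤ.* (+ b ℤ.* + b ℤ.* dedekindℤ d a ℤ.- + a ℤ.* + a ℤ.* dedekindℤ d b)
    ≡ + m ℤ.* + a ℤ.* + b ℤ.* (+ d ℤ.* + d ℤ.+ 1ℤ ℤ.- + a ℤ.* + b)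
  dedekindℤ-shift-difference d a b m refl a⊥d = ℤ.*-cancelˡ-≡ (+ d) _ _ (ℤ.*-cancelˡ-≡ (+ d) _ _ (begin
    + d ℤ.* (+ d ℤ.* (+ 3 ℤ.* (+ b ℤ.* + b ℤ.* E₁ ℤ.- + a ℤ.* + a ℤ.* E₂)))
      ≡⟨ eliminate (+ d) (+ a) (+ b) E₁ E₂ E₀ ⟩
    + b ℤ.* + b ℤ.* (+ 3 ℤ.* + d ℤ.* + d ℤ.* E₁ ℤ.+ + 3 ℤ.* + a ℤ.* + a ℤ.* E₀)
      ℤ.- + a ℤ.* + a ℤ.* (+ 3 ℤ.* + d ℤ.* + d ℤ.* E₂ ℤ.+ + 3 ℤ.* + b ℤ.* + b ℤ.* E₀)
      ≡⟨ cong₂ (λ x y → + b ℤ.* + b ℤ.* x ℤ.- + a ℤ.* + a ℤ.* y) (dedekindℤ-reciprocity d a d⊥a) reciprocity-b ⟩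
    + b ℤ.* + b ℤ.* (+ d ℤ.* + a ℤ.* (+ d ℤ.* + d ℤ.+ + a ℤ.* + a ℤ.+ 1ℤ) ℤ.- + 3 ℤ.* + d ℤ.* + d ℤ.* + a ℤ.* + a)
      ℤ.- + a ℤ.* + a ℤ.* (+ d ℤ.* + b ℤ.* (+ d ℤ.* + d ℤ.+ + b ℤ.* + b ℤ.+ 1ℤ) ℤ.- + 3 ℤ.* + d ℤ.* + d ℤ.* + b ℤ.* + b)
      ≡⟨ cong (λ x → x ℤ.* x ℤ.* (+ d ℤ.* + a ℤ.* (+ d ℤ.* + d ℤ.+ + a ℤ.* + a ℤ.+ 1ℤ) ℤ.- + 3 ℤ.* + d ℤ.* + d ℤ.* + a ℤ.* + a) ℤ.- + a ℤ.* + a ℤ.* (+ d ℤ.* x ℤ.* (+ d ℤ.* + d ℤ.+ x ℤ.* x ℤ.+ 1ℤ) ℤ.- + 3 ℤ.* + d ℤ.* + d ℤ.* x ℤ.* x)) b-cast ⟩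
    (+ a ℤ.+ + m ℤ.* + d) ℤ.* (+ a ℤ.+ + m ℤ.* + d) ℤ.* (+ d ℤ.* + a ℤ.* (+ d ℤ.* + d ℤ.+ + a ℤ.* + a ℤ.+ 1ℤ) ℤ.- + 3 ℤ.* + d ℤ.* + d ℤ.* + a ℤ.* + a) ℤ.- + a ℤ.* + a ℤ.* (+ d ℤ.* (+ a ℤ.+ + m ℤ.* + d) ℤ.* (+ d ℤ.* + d ℤ.+ (+ a ℤ.+ + m ℤ.* + d) ℤ.* (+ a ℤ.+ + m ℤ.* + d) ℤ.+ 1ℤ) ℤ.- + 3 ℤ.* + d ℤ.* + d ℤ.* (+ a ℤ.+ + m ℤ.* + d) ℤ.* (+ a ℤ.+ + m ℤ.* + d))
      ≡⟨ conclude (+ d) (+ a) (+ m) ⟩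
    + d ℤ.* (+ d ℤ.* (+ m ℤ.* + a ℤ.* (+ a ℤ.+ + m ℤ.* + d) ℤ.* (+ d ℤ.* + d ℤ.+ 1ℤ ℤ.- + a ℤ.* (+ a ℤ.+ + m ℤ.* + d))))
      ≡⟨ cong (λ x → + d ℤ.* (+ d ℤ.* (+ m ℤ.* + a ℤ.* x ℤ.* (+ d ℤ.* + d ℤ.+ 1ℤ ℤ.- + a ℤ.* x)))) b-cast ⟨
    + d ℤ.* (+ d ℤ.* (+ m ℤ.* + a ℤ.* + b ℤ.* (+ d ℤ.* + d ℤ.+ 1ℤ ℤ.- + a ℤ.* + b))) ∎))
    where
    E₀ = dedekindℤ a d
    E₁ = dedekindℤ d a
    E₂ = dedekindℤ d (a ℕ.+ m ℕ.* d)
    d⊥a = Coprime.sym a⊥d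
    reciprocity-b : + 3 ℤ.* + d ℤ.* + d ℤ.* E₂ ℤ.+ + 3 ℤ.* + b ℤ.* + b ℤ.* E₀
                  ≡ + d ℤ.* + b ℤ.* (+ d ℤ.* + d ℤ.+ + b ℤ.* + b ℤ.+ 1ℤ) ℤ.- + 3 ℤ.* + d ℤ.* + d ℤ.* + b ℤ.* + b
    reciprocity-b = trans (cong (λ x → + 3 ℤ.* + d ℤ.* + d ℤ.* E₂ ℤ.+ + 3 ℤ.* + b ℤ.* + b ℤ.* x) (sym (dedekindℤ-periodic a m d)))
                          (dedekindℤ-reciprocity d b (Coprime.sym (coprime-shift a m d a⊥d)))
    eliminate : ∀ d a b e₁ e₂ e₀ →
      d ℤ.* (d ℤ.* (+ 3 ℤ.* (b ℤ.* b ℤ.* e₁ ℤ.- a ℤ.* a ℤ.* e₂)))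
      ≡ b ℤ.* b ℤ.* (+ 3 ℤ.* d ℤ.* d ℤ.* e₁ ℤ.+ + 3 ℤ.* a ℤ.* a ℤ.* e₀) ℤ.- a ℤ.* a ℤ.* (+ 3 ℤ.* d ℤ.* d ℤ.* e₂ ℤ.+ + 3 ℤ.* b ℤ.* b ℤ.* e₀)
    eliminate = solve-∀
    b-cast : + b ≡ + a ℤ.+ + m ℤ.* + d
    b-cast = trans (ℤ.pos-+ a (m ℕ.* d)) (cong (ℤ._+_ (+ a)) (ℤ.pos-* m d))
    conclude : ∀ d a m →
      (a ℤ.+ m ℤ.* d) ℤ.* (a ℤ.+ m ℤ.* d) ℤ.* (d ℤ.* a ℤ.* (d ℤ.* d ℤ.+ a ℤ.* a ℤ.+ 1ℤ) ℤ.- + 3 ℤ.* d ℤ.* d ℤ.* a ℤ.* a) ℤ.- a ℤ.* a ℤ.* (d ℤ.* (a ℤ.+ m ℤ.* d) ℤ.* (d ℤ.* d ℤ.+ (a ℤ.+ m ℤ.* d) ℤ.* (a ℤ.+ m ℤ.* d) ℤ.+ 1ℤ) ℤ.- + 3 ℤ.* d ℤ.* d ℤ.* (a ℤ.+ m ℤ.* d) ℤ.* (a ℤ.+ m ℤ.* d))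
      ≡ d ℤ.* (d ℤ.* (m ℤ.* a ℤ.* (a ℤ.+ m ℤ.* d) ℤ.* (d ℤ.* d ℤ.+ 1ℤ ℤ.- a ℤ.* (a ℤ.+ m ℤ.* d))))
    conclude = solve-∀

  dedekind-shift-cross : ∀ d a b m .{{_ : NonZero d}} .{{_ : NonZero a}} .{{_ : NonZero b}} →
    b ≡ a ℕ.+ m ℕ.* d → Coprime a d →
    (dedekindℤ d a ℤ.* + (2 ℕ.* b ℕ.* (2 ℕ.* b)) ℤ.- dedekindℤ d b ℤ.* + (2 ℕ.* a ℕ.* (2 ℕ.* a))) ℤ.* + (12 ℕ.* a ℕ.* b ℕ.* 12)
    ≡ (+ (m ℕ.* (d ℕ.* d ℕ.+ 1)) ℤ.* + 12 ℤ.- + m ℤ.* + (12 ℕ.* a ℕ.* b)) ℤ.* + (2 ℕ.* a ℕ.* (2 ℕ.* a) ℕ.* (2 ℕ.* b ℕ.* (2 ℕ.* b)))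
  dedekind-shift-cross d@(suc _) a@(suc _) b@(suc _) m b≡a+md a⊥d = begin
    (E₁ ℤ.* + (2 ℕ.* b ℕ.* (2 ℕ.* b)) ℤ.- E₂ ℤ.* + (2 ℕ.* a ℕ.* (2 ℕ.* a))) ℤ.* + (12 ℕ.* a ℕ.* b ℕ.* 12)
      ≡⟨ cong₂ (λ x y → (E₁ ℤ.* x ℤ.- E₂ ℤ.* y) ℤ.* + (12 ℕ.* a ℕ.* b ℕ.* 12)) (cast-4x² b) (cast-4x² a) ⟩
    (E₁ ℤ.* (+ 2 ℤ.* + b ℤ.* (+ 2 ℤ.* + b)) ℤ.- E₂ ℤ.* (+ 2 ℤ.* + a ℤ.* (+ 2 ℤ.* + a))) ℤ.* + (12 ℕ.* a ℕ.* b ℕ.* 12)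
      ≡⟨ cong (ℤ._*_ (E₁ ℤ.* (+ 2 ℤ.* + b ℤ.* (+ 2 ℤ.* + b)) ℤ.- E₂ ℤ.* (+ 2 ℤ.* + a ℤ.* (+ 2 ℤ.* + a)))) (trans (ℤ.pos-* (12 ℕ.* a ℕ.* b) 12) (cong (ℤ._* + 12) cast-12ab)) ⟩
    (E₁ ℤ.* (+ 2 ℤ.* + b ℤ.* (+ 2 ℤ.* + b)) ℤ.- E₂ ℤ.* (+ 2 ℤ.* + a ℤ.* (+ 2 ℤ.* + a))) ℤ.* (+ 12 ℤ.* + a ℤ.* + b ℤ.* + 12)
      ≡⟨ regroup (+ a) (+ b) E₁ E₂ ⟩
    + 192 ℤ.* + a ℤ.* + b ℤ.* (+ 3 ℤ.* (+ b ℤ.* + b ℤ.* E₁ ℤ.- + a ℤ.* + a ℤ.* E₂))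
      ≡⟨ cong (ℤ._*_ (+ 192 ℤ.* + a ℤ.* + b)) (dedekindℤ-shift-difference d a b m b≡a+md a⊥d) ⟩
    + 192 ℤ.* + a ℤ.* + b ℤ.* (+ m ℤ.* + a ℤ.* + b ℤ.* (+ d ℤ.* + d ℤ.+ 1ℤ ℤ.- + a ℤ.* + b))
      ≡⟨ conclude (+ a) (+ b) (+ d) (+ m) ⟩
    (+ m ℤ.* (+ d ℤ.* + d ℤ.+ 1ℤ) ℤ.* + 12 ℤ.- + m ℤ.* (+ 12 ℤ.* + a ℤ.* + b)) ℤ.* (+ 2 ℤ.* + a ℤ.* (+ 2 ℤ.* + a) ℤ.* (+ 2 ℤ.* + b ℤ.* (+ 2 ℤ.* + b)))
      ≡⟨ cong₂ (λ x y → (x ℤ.* + 12 ℤ.- + m ℤ.* y) ℤ.* (+ 2 ℤ.* + a ℤ.* (+ 2 ℤ.* + a) ℤ.* (+ 2 ℤ.* + b ℤ.* (+ 2 ℤ.* + b)))) cast-m[d²+1] cast-12ab ⟨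
    (+ (m ℕ.* (d ℕ.* d ℕ.+ 1)) ℤ.* + 12 ℤ.- + m ℤ.* + (12 ℕ.* a ℕ.* b)) ℤ.* (+ 2 ℤ.* + a ℤ.* (+ 2 ℤ.* + a) ℤ.* (+ 2 ℤ.* + b ℤ.* (+ 2 ℤ.* + b)))
      ≡⟨ cong (ℤ._*_ (+ (m ℕ.* (d ℕ.* d ℕ.+ 1)) ℤ.* + 12 ℤ.- + m ℤ.* + (12 ℕ.* a ℕ.* b))) (trans (ℤ.pos-* (2 ℕ.* a ℕ.* (2 ℕ.* a)) _) (cong₂ ℤ._*_ (cast-4x² a) (cast-4x² b))) ⟨
    (+ (m ℕ.* (d ℕ.* d ℕ.+ 1)) ℤ.* + 12 ℤ.- + m ℤ.* + (12 ℕ.* a ℕ.* b)) ℤ.* + (2 ℕ.* a ℕ.* (2 ℕ.* a) ℕ.* (2 ℕ.* b ℕ.* (2 ℕ.* b))) ∎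
    where
    E₁ = dedekindℤ d a
    E₂ = dedekindℤ d b
    cast-4x² : ∀ x → + (2 ℕ.* x ℕ.* (2 ℕ.* x)) ≡ + 2 ℤ.* + x ℤ.* (+ 2 ℤ.* + x)
    cast-4x² x = trans (ℤ.pos-* (2 ℕ.* x) (2 ℕ.* x)) (cong₂ ℤ._*_ (ℤ.pos-* 2 x) (ℤ.pos-* 2 x))
    cast-12ab : + (12 ℕ.* a ℕ.* b) ≡ + 12 ℤ.* + a ℤ.* + b
    cast-12ab = trans (ℤ.pos-* (12 ℕ.* a) b) (cong (ℤ._* + b) (ℤ.pos-* 12 a))
    cast-m[d²+1] : + (m ℕ.* (d ℕ.* d ℕ.+ 1)) ≡ + m ℤ.* (+ d ℤ.* + d ℤ.+ 1ℤ)
    cast-m[d²+1] = trans (ℤ.pos-* m (d ℕ.* d ℕ.+ 1)) (cong (ℤ._*_ (+ m)) (trans (ℤ.pos-+ (d ℕ.* d) 1) (cong (ℤ._+ 1ℤ) (ℤ.pos-* d d))))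
    regroup : ∀ a b e₁ e₂ →
      (e₁ ℤ.* (+ 2 ℤ.* b ℤ.* (+ 2 ℤ.* b)) ℤ.- e₂ ℤ.* (+ 2 ℤ.* a ℤ.* (+ 2 ℤ.* a))) ℤ.* (+ 12 ℤ.* a ℤ.* b ℤ.* + 12)
      ≡ + 192 ℤ.* a ℤ.* b ℤ.* (+ 3 ℤ.* (b ℤ.* b ℤ.* e₁ ℤ.- a ℤ.* a ℤ.* e₂))
    regroup = solve-∀
    conclude : ∀ a b d m →
      + 192 ℤ.* a ℤ.* b ℤ.* (m ℤ.* a ℤ.* b ℤ.* (d ℤ.* d ℤ.+ 1ℤ ℤ.- a ℤ.* b))
      ≡ (m ℤ.* (d ℤ.* d ℤ.+ 1ℤ) ℤ.* + 12 ℤ.- m ℤ.* (+ 12 ℤ.* a ℤ.* b)) ℤ.* (+ 2 ℤ.* a ℤ.* (+ 2 ℤ.* a) ℤ.* (+ 2 ℤ.* b ℤ.* (+ 2 ℤ.* b)))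
    conclude = solve-∀

  dedekind-shift-difference : ∀ d a b m .{{_ : NonZero d}} .{{_ : NonZero a}} .{{_ : NonZero b}} →
    b ≡ a ℕ.+ m ℕ.* d → Coprime a d →
    dedekind (+ d) a - dedekind (+ d) b ≡ (+ (m ℕ.* (d ℕ.* d ℕ.+ 1))) ÷ (12 ℕ.* a ℕ.* b) - (+ m) ÷ 12
  dedekind-shift-difference d@(suc _) a@(suc _) b@(suc _) m b≡a+md a⊥d = begin
    dedekind (+ d) a - dedekind (+ d) b
      ≡⟨ cong₂ _-_ (dedekind≡dedekindℤ÷ d a) (dedekind≡dedekindℤ÷ d b) ⟩
    E₁ ÷ (2 ℕ.* a ℕ.* (2 ℕ.* a)) - E₂ ÷ (2 ℕ.* b ℕ.* (2 ℕ.* b))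
      ≡⟨ ÷-sub E₁ E₂ (2 ℕ.* a ℕ.* (2 ℕ.* a)) (2 ℕ.* b ℕ.* (2 ℕ.* b)) ⟩
    (E₁ ℤ.* + (2 ℕ.* b ℕ.* (2 ℕ.* b)) ℤ.- E₂ ℤ.* + (2 ℕ.* a ℕ.* (2 ℕ.* a))) ÷ (2 ℕ.* a ℕ.* (2 ℕ.* a) ℕ.* (2 ℕ.* b ℕ.* (2 ℕ.* b)))
      ≡⟨ ÷-cong (E₁ ℤ.* + (2 ℕ.* b ℕ.* (2 ℕ.* b)) ℤ.- E₂ ℤ.* + (2 ℕ.* a ℕ.* (2 ℕ.* a)))
                (+ (m ℕ.* (d ℕ.* d ℕ.+ 1)) ℤ.* + 12 ℤ.- + m ℤ.* + (12 ℕ.* a ℕ.* b))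
                (2 ℕ.* a ℕ.* (2 ℕ.* a) ℕ.* (2 ℕ.* b ℕ.* (2 ℕ.* b))) (12 ℕ.* a ℕ.* b ℕ.* 12) (dedekind-shift-cross d a b m b≡a+md a⊥d) ⟩
    (+ (m ℕ.* (d ℕ.* d ℕ.+ 1)) ℤ.* + 12 ℤ.- + m ℤ.* + (12 ℕ.* a ℕ.* b)) ÷ (12 ℕ.* a ℕ.* b ℕ.* 12)
      ≡⟨ ÷-sub (+ (m ℕ.* (d ℕ.* d ℕ.+ 1))) (+ m) (12 ℕ.* a ℕ.* b) 12 ⟨
    (+ (m ℕ.* (d ℕ.* d ℕ.+ 1))) ÷ (12 ℕ.* a ℕ.* b) - (+ m) ÷ 12 ∎
    where
    E₁ = dedekindℤ d a
    E₂ = dedekindℤ d b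

module ListSums where

  open import Data.Rational.Base using (ℚ; 0ℚ; _+_; _*_; _-_)
  import Data.Rational.Properties as ℚ
  open import Data.Rational.Solver using (module +-*-Solver)
  open +-*-Solver using (_:+_; _:*_; _:-_; _:=_; con) renaming (solve to ℚ-solve)
  open import Data.List.Base using (List; []; _∷_; _++_; map; filter)
  open import Data.List.Membership.Propositional using (_∈_)
  open import Data.List.Relation.Unary.Any using (here; there)
  open import Data.List.Relation.Binary.Permutation.Propositional using (_↭_; ↭⇒↭ₛ)
  import Data.List.Relation.Binary.Permutation.Setoid.Properties as PermutationProperties
  open import Algebra.Bundles using (CommutativeMonoid)
  open import Algebra.Properties.CommutativeSemigroup (CommutativeMonoid.commutativeSemigroup ℚ.+-0-commutativeMonoid)
    using (x∙yz≈y∙xz)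
  open import Function.Base using (_∘_)
  open import Relation.Nullary.Decidable using (Dec; yes; no; ¬?)
  open import Relation.Binary.PropositionalEquality as ≡ using (_≡_; refl; sym; trans; cong; cong₂)
  open import Defs using (Σℚ; Πℚ)
  open PermutationProperties (≡.setoid ℚ) using (foldr-commMonoid)

  Σℚ-↭ : ∀ {xs ys} → xs ↭ ys → Σℚ xs ≡ Σℚ ys
  Σℚ-↭ = foldr-commMonoid ℚ.+-0-isCommutativeMonoid ∘ ↭⇒↭ₛ

  Πℚ-↭ : ∀ {xs ys} → xs ↭ ys → Πℚ xs ≡ Πℚ ys
  Πℚ-↭ = foldr-commMonoid ℚ.*-1-isCommutativeMonoid ∘ ↭⇒↭ₛ

  Σℚ-++ : ∀ xs ys → Σℚ (xs ++ ys) ≡ Σℚ xs + Σℚ ys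
  Σℚ-++ []       ys = sym (ℚ.+-identityˡ (Σℚ ys))
  Σℚ-++ (x ∷ xs) ys = trans (cong (_+_ x) (Σℚ-++ xs ys)) (sym (ℚ.+-assoc x (Σℚ xs) (Σℚ ys)))

  Σℚ-cong : ∀ {A : Set} {f g : A → ℚ} xs → (∀ {x} → x ∈ xs → f x ≡ g x) → Σℚ (map f xs) ≡ Σℚ (map g xs)
  Σℚ-cong []       f≗g = refl
  Σℚ-cong (x ∷ xs) f≗g = cong₂ _+_ (f≗g (here refl)) (Σℚ-cong xs (f≗g ∘ there))

  Σℚ-zero : ∀ {A : Set} {f : A → ℚ} xs → (∀ {x} → x ∈ xs → f x ≡ 0ℚ) → Σℚ (map f xs) ≡ 0ℚ
  Σℚ-zero []       f≡0 = refl
  Σℚ-zero (x ∷ xs) f≡0 = trans (cong₂ _+_ (f≡0 (here refl)) (Σℚ-zero xs (f≡0 ∘ there))) (ℚ.+-identityˡ 0ℚ)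

  *-distribˡ-Σℚ : ∀ {A : Set} a (f : A → ℚ) xs → a * Σℚ (map f xs) ≡ Σℚ (map (λ x → a * f x) xs)
  *-distribˡ-Σℚ a f []       = ℚ.*-zeroʳ a
  *-distribˡ-Σℚ a f (x ∷ xs) = trans (ℚ.*-distribˡ-+ a (f x) _) (cong (_+_ (a * f x)) (*-distribˡ-Σℚ a f xs))

  Σℚ-linear : ∀ {A : Set} a b (f g : A → ℚ) xs →
              Σℚ (map (λ x → a * f x - b * g x) xs) ≡ a * Σℚ (map f xs) - b * Σℚ (map g xs)
  Σℚ-linear a b f g []       = ℚ-solve 2 (λ a b → con 0ℚ := a :* con 0ℚ :- b :* con 0ℚ) refl a b
  Σℚ-linear a b f g (x ∷ xs) = trans (cong (_+_ (a * f x - b * g x)) (Σℚ-linear a b f g xs))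
    (ℚ-solve 6 (λ a b u v s t → (a :* u :- b :* v) :+ (a :* s :- b :* t) := a :* (u :+ s) :- b :* (v :+ t)) refl
               a b (f x) (g x) (Σℚ (map f xs)) (Σℚ (map g xs)))

  Πℚ-zero : ∀ {A : Set} {f : A → ℚ} {x} xs → x ∈ xs → f x ≡ 0ℚ → Πℚ (map f xs) ≡ 0ℚ
  Πℚ-zero {f = f} (y ∷ xs) (here refl) fx≡0 = trans (cong (_* Πℚ (map f xs)) fx≡0) (ℚ.*-zeroˡ (Πℚ (map f xs)))
  Πℚ-zero {f = f} (y ∷ xs) (there x∈) fx≡0 = trans (cong (f y *_) (Πℚ-zero xs x∈ fx≡0)) (ℚ.*-zeroʳ (f y))

  Σℚ-partition : ∀ {A : Set} {P : A → Set} (P? : ∀ x → Dec (P x)) (f : A → ℚ) xs →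
    Σℚ (map f xs) ≡ Σℚ (map f (filter P? xs)) + Σℚ (map f (filter (¬? ∘ P?) xs))
  Σℚ-partition P? f [] = sym (ℚ.+-identityˡ 0ℚ)
  Σℚ-partition P? f (x ∷ xs) with P? x
  ... | yes _ = trans (cong (_+_ (f x)) (Σℚ-partition P? f xs)) (sym (ℚ.+-assoc (f x) _ _))
  ... | no  _ = trans (cong (_+_ (f x)) (Σℚ-partition P? f xs)) (x∙yz≈y∙xz (f x) (Σℚ (map f (filter P? xs))) (Σℚ (map f (filter (¬? ∘ P?) xs))))

module Mobius where

  open import Data.Bool.Base using (Bool; true; false; T; if_then_else_)
  open import Data.Bool.Properties using (T-≡; T?)
  open import Data.Bool.ListAction using (any)
  open import Data.Nat.Base as ℕ using (ℕ; zero; suc; NonZero)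
  import Data.Nat.Properties as ℕ
  open import Data.Nat.Divisibility as ∣ using (_∣_; _∤_; _∣?_; divides; ∣⇒≤; ∣-trans; n∣m*n; m∣m*n)
  open import Data.Nat.Coprimality as Coprime using (Coprime; coprime-divisor)
  open import Data.Nat.ListAction using (product)
  open import Data.Nat.Primality.Factorisation using (factorise)
  open import Data.Nat.Primality using (Prime; prime?; euclidsLemma; prime⇒irreducible; prime⇒nonZero; productOfPrimes≢0)
  open import Data.Integer.Base as ℤ using (ℤ; +_; 0ℤ; 1ℤ)
  import Data.Integer.Properties as ℤ
  open import Data.Rational.Base using (ℚ; 0ℚ; 1ℚ; _+_; _*_; _-_; -_)
  import Data.Rational.Properties as ℚ
  open import Data.Rational.Solver using (module +-*-Solver)
  open +-*-Solver using (_:+_; _:*_; :-_; _:-_; _:=_; con) renaming (solve to ℚ-solve)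
  open import Data.List.Base using (List; []; _∷_; _++_; map; filter; upTo; length)
  open import Data.List.Properties using (map-++; map-∘)
  open import Data.List.Membership.Propositional using (_∈_; find; lose)
  open import Data.List.Membership.Propositional.Properties
    using (∈-filter⁺; ∈-filter⁻; ∈-map⁺; ∈-map⁻; ∈-upTo⁺; ++-∈⇔)
  open import Data.List.Membership.Propositional.Properties.WithK using (unique∧set⇒bag)
  open import Data.List.Relation.Unary.All as All using (All)
  open import Data.List.Relation.Unary.Any using (here; there)
  open import Data.List.Relation.Unary.Any.Properties using (any⁺; any⁻)
  open import Data.List.Relation.Unary.Unique.Propositional using (Unique)
  import Data.List.Relation.Unary.Unique.Propositional.Properties as Unique
  open import Data.List.Relation.Binary.Permutation.Propositional using (_↭_)
  open import Data.List.Relation.Binary.Permutation.Propositional.Properties as ↭ using (↭-length)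
  open import Data.List.Relation.Binary.BagAndSetEquality using (∼bag⇒↭)
  open import Data.Product.Base using (∃; _×_; _,_; proj₁; proj₂)
  open import Data.Sum.Base using (inj₁; inj₂; [_,_])
  open import Function.Base using (_∘_; id)
  open import Function.Bundles using (_⇔_; mk⇔; Equivalence)
  open import Relation.Nullary.Decidable using (Dec; yes; no; does; _×-dec_; ¬?; does-⇔)
  open import Relation.Nullary.Negation using (¬_; contradiction)
  open import Relation.Binary.PropositionalEquality
    using (_≡_; refl; sym; trans; cong; cong₂; subst; module ≡-Reasoning)
  open import Defs using (μ; divisors; primeDivisors; Σℚ; Πℚ; _÷_)
  open Fraction using (÷-neg)
  open ListSums

  unique∧same-members⇒↭ : ∀ {xs ys : List ℕ} → Unique xs → Unique ys → (∀ {x} → x ∈ xs ⇔ x ∈ ys) → xs ↭ ys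
  unique∧same-members⇒↭ xs! ys! xs≈ys = ∼bag⇒↭ (unique∧set⇒bag xs! ys! xs≈ys)

  ∈-divisors⁻ : ∀ {n v} → v ∈ divisors n → v ∣ n
  ∈-divisors⁻ {n} v∈ = proj₂ (∈-filter⁻ (_∣? n) {xs = map suc (upTo n)} v∈)

  ∈-divisors⁺ : ∀ {n v} .{{_ : NonZero n}} → v ∣ n → v ∈ divisors n
  ∈-divisors⁺ {n} {zero}  0∣n = contradiction (∣.0∣⇒≡0 0∣n) (ℕ.≢-nonZero⁻¹ n)
  ∈-divisors⁺ {n} {suc v} v∣n = ∈-filter⁺ (_∣? n) (∈-map⁺ suc (∈-upTo⁺ (∣⇒≤ v∣n))) v∣n

  divisors-unique : ∀ n → Unique (divisors n)
  divisors-unique n = Unique.filter⁺ (_∣? n) (Unique.map⁺ ℕ.suc-injective (Unique.upTo⁺ n))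

  ∈-primeDivisors⁻ : ∀ {n p} → p ∈ primeDivisors n → Prime p × p ∣ n
  ∈-primeDivisors⁻ {n} p∈ = proj₂ (∈-filter⁻ (λ q → prime? q ×-dec (q ∣? n)) {xs = divisors n} p∈)

  ∈-primeDivisors⁺ : ∀ {n p} .{{_ : NonZero n}} → Prime p → p ∣ n → p ∈ primeDivisors n
  ∈-primeDivisors⁺ {n} p-prime p∣n = ∈-filter⁺ (λ q → prime? q ×-dec (q ∣? n)) (∈-divisors⁺ p∣n) (p-prime , p∣n)

  primeDivisors-unique : ∀ n → Unique (primeDivisors n)
  primeDivisors-unique n = Unique.filter⁺ (λ q → prime? q ×-dec (q ∣? n)) (divisors-unique n)

  prime∣prime⇒≡ : ∀ {p q} → Prime p → Prime q → q ∣ p → q ≡ p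
  prime∣prime⇒≡ p-prime q-prime q∣p with prime⇒irreducible p-prime q∣p
  ... | inj₁ refl = contradiction q-prime λ ()
  ... | inj₂ q≡p  = q≡p

  module _ {p w : ℕ} .{{_ : NonZero w}} (p-prime : Prime p) where

    private instance
      p≢0 : NonZero p
      p≢0 = prime⇒nonZero p-prime
      pw≢0 : NonZero (p ℕ.* w)
      pw≢0 = ℕ.m*n≢0 p w

    primeDivisors-*-∤ : p ∤ w → primeDivisors (p ℕ.* w) ↭ p ∷ primeDivisors w
    primeDivisors-*-∤ p∤w = unique∧same-members⇒↭ (primeDivisors-unique (p ℕ.* w)) p∷pd-unique (mk⇔ to from)
      where
      p∷pd-unique : Unique (p ∷ primeDivisors w)
      p∷pd-unique = All.tabulate (λ q∈ p≡q → p∤w (subst (_∣ w) (sym p≡q) (proj₂ (∈-primeDivisors⁻ {w} q∈)))) Unique.∷ primeDivisors-unique w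
      to : ∀ {q} → q ∈ primeDivisors (p ℕ.* w) → q ∈ p ∷ primeDivisors w
      to q∈ with ∈-primeDivisors⁻ {p ℕ.* w} q∈
      ... | q-prime , q∣pw with euclidsLemma p w q-prime q∣pw
      ...   | inj₁ q∣p = here (prime∣prime⇒≡ p-prime q-prime q∣p)
      ...   | inj₂ q∣w = there (∈-primeDivisors⁺ q-prime q∣w)
      from : ∀ {q} → q ∈ p ∷ primeDivisors w → q ∈ primeDivisors (p ℕ.* w)
      from (here refl) = ∈-primeDivisors⁺ p-prime (m∣m*n w)
      from (there q∈)  = ∈-primeDivisors⁺ (proj₁ (∈-primeDivisors⁻ {w} q∈)) (∣-trans (proj₂ (∈-primeDivisors⁻ {w} q∈)) (n∣m*n p))

    primeDivisors-*-∣ : p ∣ w → primeDivisors (p ℕ.* w) ↭ primeDivisors w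
    primeDivisors-*-∣ p∣w = unique∧same-members⇒↭ (primeDivisors-unique (p ℕ.* w)) (primeDivisors-unique w) (mk⇔ to from)
      where
      to : ∀ {q} → q ∈ primeDivisors (p ℕ.* w) → q ∈ primeDivisors w
      to q∈ with ∈-primeDivisors⁻ {p ℕ.* w} q∈
      ... | q-prime , q∣pw with euclidsLemma p w q-prime q∣pw
      ...   | inj₁ q∣p = ∈-primeDivisors⁺ q-prime (subst (_∣ w) (sym (prime∣prime⇒≡ p-prime q-prime q∣p)) p∣w)
      ...   | inj₂ q∣w = ∈-primeDivisors⁺ q-prime q∣w
      from : ∀ {q} → q ∈ primeDivisors w → q ∈ primeDivisors (p ℕ.* w)
      from q∈ = ∈-primeDivisors⁺ (proj₁ (∈-primeDivisors⁻ {w} q∈)) (∣-trans (proj₂ (∈-primeDivisors⁻ {w} q∈)) (n∣m*n p))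

  T-does⇒ : ∀ {P : Set} (P? : Dec P) → T (does P?) → P
  T-does⇒ (yes p) _ = p

  ⇒T-does : ∀ {P : Set} (P? : Dec P) → P → T (does P?)
  ⇒T-does (yes _) _ = _
  ⇒T-does (no ¬p) p = ¬p p

  Squareful : ℕ → Set
  Squareful n = ∃ λ q → Prime q × q ℕ.* q ∣ n

  any-square⇔squareful : ∀ {n} .{{_ : NonZero n}} → T (any (λ q → does (q ℕ.* q ∣? n)) (primeDivisors n)) ⇔ Squareful n
  any-square⇔squareful {n} = mk⇔ to from
    where
    to : T (any (λ q → does (q ℕ.* q ∣? n)) (primeDivisors n)) → Squareful n
    to t with find (any⁻ (λ q → does (q ℕ.* q ∣? n)) (primeDivisors n) t)
    ... | q , q∈ , q²∣n = q , proj₁ (∈-primeDivisors⁻ {n} q∈) , T-does⇒ (q ℕ.* q ∣? n) q²∣n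
    from : Squareful n → T (any (λ q → does (q ℕ.* q ∣? n)) (primeDivisors n))
    from (q , q-prime , q²∣n) = any⁺ _ (lose (∈-primeDivisors⁺ q-prime (∣-trans (m∣m*n q) q²∣n)) (⇒T-does (q ℕ.* q ∣? n) q²∣n))

  μ-squareful : ∀ {n} .{{_ : NonZero n}} → Squareful n → μ n ≡ 0ℤ
  μ-squareful {n} sq = cong (λ b → if b then + 0 else (ℤ.- 1ℤ) ℤ.^ length (primeDivisors n))
                            (Equivalence.to T-≡ (Equivalence.from any-square⇔squareful sq))

  squareful-*-∤ : ∀ {p w} → Prime p → p ∤ w → Squareful (p ℕ.* w) → Squareful w
  squareful-*-∤ {p} {w} p-prime p∤w (q , q-prime , q²∣pw) with q ℕ.≟ p
  ... | yes refl = contradiction (∣.*-cancelˡ-∣ p {{prime⇒nonZero p-prime}} q²∣pw) p∤w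
  ... | no  q≢p  = q , q-prime , coprime-divisor q²⊥p q²∣pw
    where
    q²⊥p : Coprime (q ℕ.* q) p
    q²⊥p {i} (i∣q² , i∣p) with prime⇒irreducible p-prime i∣p
    ... | inj₁ i≡1 = i≡1
    ... | inj₂ refl = contradiction (prime∣prime⇒≡ q-prime p-prime ([ id , id ] (euclidsLemma q q p-prime i∣q²))) (q≢p ∘ sym)

  μ-*-∤ : ∀ {p w} .{{_ : NonZero w}} → Prime p → p ∤ w → μ (p ℕ.* w) ≡ ℤ.- μ w
  μ-*-∤ {p} {w} p-prime p∤w = begin
    μ (p ℕ.* w)                         ≡⟨ cong₂ (λ b l → if b then + 0 else (ℤ.- 1ℤ) ℤ.^ l) same-squarefulness (↭-length (primeDivisors-*-∤ p-prime p∤w)) ⟩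
    sign-flip (any-square w) (length (primeDivisors w)) ≡⟨ sign-flip≡-μ (any-square w) ⟩
    ℤ.- μ w ∎
    where
    open ≡-Reasoning
    instance
      pw≢0 : NonZero (p ℕ.* w)
      pw≢0 = ℕ.m*n≢0 p w {{prime⇒nonZero p-prime}}
    any-square : ℕ → Bool
    any-square n = any (λ q → does (q ℕ.* q ∣? n)) (primeDivisors n)
    sign-flip : Bool → ℕ → ℤ
    sign-flip b l = if b then + 0 else (ℤ.- 1ℤ) ℤ.^ suc l
    sign-flip≡-μ : ∀ b → sign-flip b (length (primeDivisors w)) ≡ ℤ.- (if b then + 0 else (ℤ.- 1ℤ) ℤ.^ length (primeDivisors w))
    sign-flip≡-μ true  = refl
    sign-flip≡-μ false = ℤ.-1*i≡-i _
    same-squarefulness : any-square (p ℕ.* w) ≡ any-square w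
    same-squarefulness = does-⇔ (mk⇔ (Equivalence.from any-square⇔squareful ∘ squareful-*-∤ p-prime p∤w ∘ Equivalence.to any-square⇔squareful)
                                     (Equivalence.from any-square⇔squareful ∘ squareful-∣ ∘ Equivalence.to any-square⇔squareful))
                                 (T? (any-square (p ℕ.* w))) (T? (any-square w))
      where
      squareful-∣ : Squareful w → Squareful (p ℕ.* w)
      squareful-∣ (q , q-prime , q²∣w) = q , q-prime , ∣-trans q²∣w (n∣m*n p)

  prime∤⇒coprime : ∀ {p v} → Prime p → p ∤ v → Coprime p v
  prime∤⇒coprime p-prime p∤v {i} (i∣p , i∣v) with prime⇒irreducible p-prime i∣p
  ... | inj₁ i≡1  = i≡1
  ... | inj₂ refl = contradiction i∣v p∤v

  module _ {p M : ℕ} .{{_ : NonZero M}} (p-prime : Prime p) where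

    private instance
      p≢0 : NonZero p
      p≢0 = prime⇒nonZero p-prime
      pM≢0 : NonZero (p ℕ.* M)
      pM≢0 = ℕ.m*n≢0 p M

    divisors-*-∤ : p ∤ M → divisors (p ℕ.* M) ↭ divisors M ++ map (p ℕ.*_) (divisors M)
    divisors-*-∤ p∤M = unique∧same-members⇒↭ (divisors-unique (p ℕ.* M)) split-unique (mk⇔ to from)
      where
      split-unique : Unique (divisors M ++ map (p ℕ.*_) (divisors M))
      split-unique = Unique.++⁺ (divisors-unique M) (Unique.map⁺ (ℕ.*-cancelˡ-≡ _ _ p) (divisors-unique M)) disjoint
        where
        disjoint : ∀ {v} → ¬ (v ∈ divisors M × v ∈ map (p ℕ.*_) (divisors M))
        disjoint (v∈ , pw∈) with ∈-map⁻ (p ℕ.*_) pw∈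
        ... | w , _ , refl = p∤M (∣-trans (m∣m*n w) (∈-divisors⁻ v∈))
      to : ∀ {v} → v ∈ divisors (p ℕ.* M) → v ∈ divisors M ++ map (p ℕ.*_) (divisors M)
      to {v} v∈ with p ∣? v
      ... | yes (divides w refl) = Equivalence.from ++-∈⇔ (inj₂ (subst (_∈ map (p ℕ.*_) (divisors M)) (ℕ.*-comm p w)
                                      (∈-map⁺ (p ℕ.*_) (∈-divisors⁺ (∣.*-cancelˡ-∣ p (subst (_∣ p ℕ.* M) (ℕ.*-comm w p) (∈-divisors⁻ v∈)))))))
      ... | no  p∤v              = Equivalence.from ++-∈⇔ (inj₁ (∈-divisors⁺ (coprime-divisor (Coprime.sym (prime∤⇒coprime p-prime p∤v)) (∈-divisors⁻ v∈))))
      from : ∀ {v} → v ∈ divisors M ++ map (p ℕ.*_) (divisors M) → v ∈ divisors (p ℕ.* M)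
      from v∈ with Equivalence.to ++-∈⇔ v∈
      ... | inj₁ v∈M  = ∈-divisors⁺ (∣-trans (∈-divisors⁻ v∈M) (n∣m*n p))
      ... | inj₂ pw∈  with ∈-map⁻ (p ℕ.*_) pw∈
      ...   | w , w∈M , refl = ∈-divisors⁺ (∣.*-monoʳ-∣ p (∈-divisors⁻ w∈M))

    divisors-*-∣ : p ∣ M → filter (_∣? M) (divisors (p ℕ.* M)) ↭ divisors M
    divisors-*-∣ p∣M = unique∧same-members⇒↭ (Unique.filter⁺ (_∣? M) (divisors-unique (p ℕ.* M))) (divisors-unique M) (mk⇔ to from)
      where
      to : ∀ {v} → v ∈ filter (_∣? M) (divisors (p ℕ.* M)) → v ∈ divisors M
      to v∈ = ∈-divisors⁺ (proj₂ (∈-filter⁻ (_∣? M) {xs = divisors (p ℕ.* M)} v∈))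
      from : ∀ {v} → v ∈ divisors M → v ∈ filter (_∣? M) (divisors (p ℕ.* M))
      from v∈ = ∈-filter⁺ (_∣? M) (∈-divisors⁺ (∣-trans (∈-divisors⁻ v∈) (n∣m*n p))) (∈-divisors⁻ v∈)

    squareful-new-divisor : p ∣ M → ∀ {v} → v ∣ p ℕ.* M → v ∤ M → Squareful v
    squareful-new-divisor p∣M {v} v∣pM v∤M with p ∣? v
    ... | no  p∤v = contradiction (coprime-divisor (Coprime.sym (prime∤⇒coprime p-prime p∤v)) v∣pM) v∤M
    ... | yes (divides w refl) with p ∣? w
    ...   | yes p∣w = p , p-prime , ∣.*-monoˡ-∣ p p∣w
    ...   | no  p∤w = contradiction wp∣M v∤M
      where
      wp∣M : w ℕ.* p ∣ M
      wp∣M with ∣.*-cancelˡ-∣ p (subst (_∣ p ℕ.* M) (ℕ.*-comm w p) v∣pM)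
      ... | divides t M≡tw with euclidsLemma t w p-prime (subst (p ∣_) M≡tw p∣M)
      ...   | inj₁ (divides u refl) = divides u (trans M≡tw (trans (ℕ.*-assoc u p w) (cong (u ℕ.*_) (ℕ.*-comm p w))))
      ...   | inj₂ p∣w              = contradiction p∣w p∤w

  divisor-nonZero : ∀ {v n} .{{_ : NonZero n}} → v ∣ n → NonZero v
  divisor-nonZero {zero}  {n} 0∣n = contradiction (∣.0∣⇒≡0 0∣n) (ℕ.≢-nonZero⁻¹ n)
  divisor-nonZero {suc _}     _   = _

  module DivisorSums (F : ℕ → ℚ) where

    Σμ Π[1-F] : ℕ → ℚ
    Σμ     n = Σℚ (map (λ v → (μ v ÷ 1) * F v) (divisors n))
    Π[1-F] n = Πℚ (map (λ p → 1ℚ - F p) (primeDivisors n))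

    Σμ-*-∣ : ∀ {p M} .{{_ : NonZero M}} → Prime p → p ∣ M → Σμ (p ℕ.* M) ≡ Σμ M
    Σμ-*-∣ {p} {M} p-prime p∣M = begin
      Σμ (p ℕ.* M)
        ≡⟨ Σℚ-partition (_∣? M) term (divisors (p ℕ.* M)) ⟩
      Σℚ (map term (filter (_∣? M) (divisors (p ℕ.* M)))) + Σℚ (map term (filter (¬? ∘ (_∣? M)) (divisors (p ℕ.* M))))
        ≡⟨ cong₂ _+_ (Σℚ-↭ (↭.map⁺ term (divisors-*-∣ p-prime p∣M))) (Σℚ-zero (filter (¬? ∘ (_∣? M)) (divisors (p ℕ.* M))) new-divisor-term) ⟩
      Σμ M + 0ℚ
        ≡⟨ ℚ.+-identityʳ (Σμ M) ⟩
      Σμ M ∎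
      where
      open ≡-Reasoning
      term : ℕ → ℚ
      term v = (μ v ÷ 1) * F v
      instance
        pM≢0 : NonZero (p ℕ.* M)
        pM≢0 = ℕ.m*n≢0 p M {{prime⇒nonZero p-prime}}
      new-divisor-term : ∀ {v} → v ∈ filter (¬? ∘ (_∣? M)) (divisors (p ℕ.* M)) → term v ≡ 0ℚ
      new-divisor-term {v} v∈ with ∈-filter⁻ (¬? ∘ (_∣? M)) {xs = divisors (p ℕ.* M)} v∈
      ... | v∈pM , v∤M = begin
        (μ v ÷ 1) * F v  ≡⟨ cong (λ i → (i ÷ 1) * F v) (μ-squareful {{divisor-nonZero v∣pM}} (squareful-new-divisor p-prime p∣M v∣pM v∤M)) ⟩
        0ℚ * F v         ≡⟨ ℚ.*-zeroˡ (F v) ⟩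
        0ℚ               ∎
        where
        v∣pM = ∈-divisors⁻ v∈pM

    Σμ-*-∤ : (∀ a b .{{_ : NonZero a}} .{{_ : NonZero b}} → F (a ℕ.* b) ≡ F a * F b) →
             ∀ {p M} .{{_ : NonZero M}} → Prime p → p ∤ M → Σμ (p ℕ.* M) ≡ (1ℚ - F p) * Σμ M
    Σμ-*-∤ F-* {p} {M} p-prime p∤M = begin
      Σμ (p ℕ.* M)
        ≡⟨ Σℚ-↭ (↭.map⁺ term (divisors-*-∤ p-prime p∤M)) ⟩
      Σℚ (map term (divisors M ++ map (p ℕ.*_) (divisors M)))
        ≡⟨ cong Σℚ (map-++ term (divisors M) (map (p ℕ.*_) (divisors M))) ⟩
      Σℚ (map term (divisors M) ++ map term (map (p ℕ.*_) (divisors M)))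
        ≡⟨ Σℚ-++ (map term (divisors M)) (map term (map (p ℕ.*_) (divisors M))) ⟩
      Σμ M + Σℚ (map term (map (p ℕ.*_) (divisors M)))
        ≡⟨ cong (_+_ (Σμ M)) (trans (cong Σℚ (sym (map-∘ (divisors M)))) (Σℚ-cong (divisors M) multiple-term)) ⟩
      Σμ M + Σℚ (map (λ w → (- F p) * term w) (divisors M))
        ≡⟨ cong (_+_ (Σμ M)) (*-distribˡ-Σℚ (- F p) term (divisors M)) ⟨
      Σμ M + (- F p) * Σμ M
        ≡⟨ ℚ-solve 2 (λ a s → s :+ (:- a) :* s := (con 1ℚ :- a) :* s) refl (F p) (Σμ M) ⟩
      (1ℚ - F p) * Σμ M ∎
      where
      open ≡-Reasoning
      term : ℕ → ℚ
      term v = (μ v ÷ 1) * F v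
      multiple-term : ∀ {w} → w ∈ divisors M → term (p ℕ.* w) ≡ (- F p) * term w
      multiple-term {w} w∈ = begin
        (μ (p ℕ.* w) ÷ 1) * F (p ℕ.* w)   ≡⟨ cong₂ (λ i x → (i ÷ 1) * x) (μ-*-∤ p-prime p∤w) (F-* p w {{prime⇒nonZero p-prime}}) ⟩
        ((ℤ.- μ w) ÷ 1) * (F p * F w)     ≡⟨ cong (_* (F p * F w)) (÷-neg (μ w) 1) ⟨
        (- (μ w ÷ 1)) * (F p * F w)       ≡⟨ ℚ-solve 3 (λ m a b → (:- m) :* (a :* b) := (:- a) :* (m :* b)) refl (μ w ÷ 1) (F p) (F w) ⟩
        (- F p) * ((μ w ÷ 1) * F w)       ∎
        where
        instance
          w≢0 : NonZero w
          w≢0 = divisor-nonZero (∈-divisors⁻ {M} w∈)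
        p∤w : p ∤ w
        p∤w p∣w = p∤M (∣-trans p∣w (∈-divisors⁻ {M} w∈))

    Σμ≡Π[1-F] : F 1 ≡ 1ℚ → (∀ a b .{{_ : NonZero a}} .{{_ : NonZero b}} → F (a ℕ.* b) ≡ F a * F b) →
                ∀ N .{{_ : NonZero N}} → Σμ N ≡ Π[1-F] N
    Σμ≡Π[1-F] F-1 F-* N with factorise N
    ... | record { factors = ps ; isFactorisation = refl ; factorsPrime = ps-prime } = over-product ps-prime
      where
      over-product : ∀ {ps} → All Prime ps → Σμ (product ps) ≡ Π[1-F] (product ps)
      over-product {[]}     All.[]                     = cong (λ x → (μ 1 ÷ 1) * x + 0ℚ) F-1
      over-product {p ∷ ps} (p-prime All.∷ ps-prime) with p ∣? product ps
      ... | yes p∣M = trans (Σμ-*-∣ {{M≢0}} p-prime p∣M)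
                     (trans (over-product ps-prime) (sym (Πℚ-↭ (↭.map⁺ (λ q → 1ℚ - F q) (primeDivisors-*-∣ {{M≢0}} p-prime p∣M)))))
        where M≢0 = productOfPrimes≢0 ps-prime
      ... | no  p∤M = trans (Σμ-*-∤ F-* {{M≢0}} p-prime p∤M)
                     (trans (cong ((1ℚ - F p) *_) (over-product ps-prime)) (sym (Πℚ-↭ (↭.map⁺ (λ q → 1ℚ - F q) (primeDivisors-*-∤ {{M≢0}} p-prime p∤M)))))
        where M≢0 = productOfPrimes≢0 ps-prime

  Π[1-1]≡0 : ∀ N .{{_ : NonZero N}} → 2 ℕ.≤ N → Πℚ (map (λ p → 1ℚ - 1ℚ) (primeDivisors N)) ≡ 0ℚ
  Π[1-1]≡0 N 2≤N with factorise N
  ... | record { factors = [] ; isFactorisation = N≡1 } = contradiction N≡1 (λ N≡1 → ℕ.<⇒≢ 2≤N (sym N≡1))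
  ... | record { factors = p ∷ ps ; isFactorisation = refl ; factorsPrime = p-prime All.∷ _ } =
    Πℚ-zero (primeDivisors N) (∈-primeDivisors⁺ p-prime (m∣m*n (product ps))) refl

module DivisorSum where

  open import Data.Nat.Base as ℕ using (ℕ; suc; NonZero)
  import Data.Nat.Properties as ℕ
  open import Data.Nat.DivMod using (m*n/n≡m)
  open import Data.Nat.Divisibility using (_∣_; ∣-trans; *-monoˡ-∣)
  open import Data.Nat.Coprimality using (Coprime)
  open import Data.Nat.Tactic.RingSolver using (solve-∀)
  open import Data.Integer.Base as ℤ using (ℤ; +_)
  import Data.Integer.Properties as ℤ
  open import Data.Rational.Base using (1ℚ; _*_; _-_)
  open import Data.Rational.Solver using (module +-*-Solver)
  open +-*-Solver using (_:*_; _:-_; _:=_; con) renaming (solve to ℚ-solve)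
  open import Data.Product.Base using (_,_)
  open import Relation.Binary.PropositionalEquality using (_≡_; refl; sym; trans; cong; cong₂; subst; module ≡-Reasoning)
  open import Defs
  open Fraction
  open Difference
  open Mobius

  scaled-main-term : ∀ N c₀ d k v .{{_ : NonZero N}} .{{_ : NonZero c₀}} .{{_ : NonZero d}} .{{_ : NonZero v}} →
    ((+ 1) ÷ v) * ((+ (v ℕ.* k ℕ.* (d ℕ.* d ℕ.+ 1))) ÷ (12 ℕ.* (v ℕ.* c₀) ℕ.* (v ℕ.* c₀ ℕ.+ v ℕ.* k ℕ.* d)))
    ≡ ((+ (N ℕ.* N ℕ.* k ℕ.* (d ℕ.* d ℕ.+ 1))) ÷ (12 ℕ.* (c₀ ℕ.* N) ℕ.* (c₀ ℕ.* N ℕ.+ k ℕ.* N ℕ.* d))) * ((+ 1) ÷ (v ℕ.* v))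
  scaled-main-term N@(suc _) c₀@(suc _) d@(suc _) k v@(suc _) = begin
    ((+ 1) ÷ v) * ((+ (v ℕ.* k ℕ.* (d ℕ.* d ℕ.+ 1))) ÷ D)
      ≡⟨ ÷-*-ℕ 1 (v ℕ.* k ℕ.* (d ℕ.* d ℕ.+ 1)) v D ⟩
    (+ (1 ℕ.* (v ℕ.* k ℕ.* (d ℕ.* d ℕ.+ 1)))) ÷ (v ℕ.* D)
      ≡⟨ ÷-cong-ℕ (1 ℕ.* (v ℕ.* k ℕ.* (d ℕ.* d ℕ.+ 1))) (N ℕ.* N ℕ.* k ℕ.* (d ℕ.* d ℕ.+ 1) ℕ.* 1)
                  (v ℕ.* D) (D′ ℕ.* (v ℕ.* v)) (cross N c₀ d k v) ⟩
    (+ (N ℕ.* N ℕ.* k ℕ.* (d ℕ.* d ℕ.+ 1) ℕ.* 1)) ÷ (D′ ℕ.* (v ℕ.* v))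
      ≡⟨ ÷-*-ℕ (N ℕ.* N ℕ.* k ℕ.* (d ℕ.* d ℕ.+ 1)) 1 D′ (v ℕ.* v) ⟨
    ((+ (N ℕ.* N ℕ.* k ℕ.* (d ℕ.* d ℕ.+ 1))) ÷ D′) * ((+ 1) ÷ (v ℕ.* v)) ∎
    where
    open ≡-Reasoning
    D  = 12 ℕ.* (v ℕ.* c₀) ℕ.* (v ℕ.* c₀ ℕ.+ v ℕ.* k ℕ.* d)
    D′ = 12 ℕ.* (c₀ ℕ.* N) ℕ.* (c₀ ℕ.* N ℕ.+ k ℕ.* N ℕ.* d)
    cross : ∀ N c₀ d k v →
      1 ℕ.* (v ℕ.* k ℕ.* (d ℕ.* d ℕ.+ 1)) ℕ.* (12 ℕ.* (c₀ ℕ.* N) ℕ.* (c₀ ℕ.* N ℕ.+ k ℕ.* N ℕ.* d) ℕ.* (v ℕ.* v))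
      ≡ N ℕ.* N ℕ.* k ℕ.* (d ℕ.* d ℕ.+ 1) ℕ.* 1 ℕ.* (v ℕ.* (12 ℕ.* (v ℕ.* c₀) ℕ.* (v ℕ.* c₀ ℕ.+ v ℕ.* k ℕ.* d)))
    cross = solve-∀

  scaled-correction-term : ∀ k v .{{_ : NonZero v}} → ((+ 1) ÷ v) * ((+ (v ℕ.* k)) ÷ 12) ≡ (+ k) ÷ 12
  scaled-correction-term k v@(suc _) =
    trans (÷-*-ℕ 1 (v ℕ.* k) v 12) (÷-cong-ℕ (1 ℕ.* (v ℕ.* k)) k (v ℕ.* 12) 12 (cancel-v k v))
    where
    cancel-v : ∀ k v → 1 ℕ.* (v ℕ.* k) ℕ.* 12 ≡ k ℕ.* (v ℕ.* 12)
    cancel-v = solve-∀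

  divisor-term : ∀ (i : ℤ) N c₀ d k v .{{_ : NonZero N}} .{{_ : NonZero c₀}} .{{_ : NonZero d}} .{{_ : NonZero v}} →
    Coprime (v ℕ.* c₀) d →
    (i ÷ v) * (dedekind (+ d) (v ℕ.* c₀) - dedekind (+ d) (v ℕ.* c₀ ℕ.+ v ℕ.* k ℕ.* d))
    ≡ ((+ (N ℕ.* N ℕ.* k ℕ.* (d ℕ.* d ℕ.+ 1))) ÷ (12 ℕ.* (c₀ ℕ.* N) ℕ.* (c₀ ℕ.* N ℕ.+ k ℕ.* N ℕ.* d)))
        * ((i ÷ 1) * ((+ 1) ÷ (v ℕ.* v)))
      - ((+ k) ÷ 12) * ((i ÷ 1) * 1ℚ)
  divisor-term i N@(suc _) c₀@(suc _) d@(suc _) k v@(suc _) vc₀⊥d = begin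
    (i ÷ v) * (dedekind (+ d) a - dedekind (+ d) b)
      ≡⟨ cong₂ _*_ i÷v≡ (dedekind-shift-difference d a b (v ℕ.* k) refl vc₀⊥d) ⟩
    ((i ÷ 1) * v⁻¹) * ((+ (v ℕ.* k ℕ.* (d ℕ.* d ℕ.+ 1))) ÷ (12 ℕ.* a ℕ.* b) - (+ (v ℕ.* k)) ÷ 12)
      ≡⟨ distribute (i ÷ 1) v⁻¹ ((+ (v ℕ.* k ℕ.* (d ℕ.* d ℕ.+ 1))) ÷ (12 ℕ.* a ℕ.* b)) ((+ (v ℕ.* k)) ÷ 12) ⟩
    (i ÷ 1) * (v⁻¹ * ((+ (v ℕ.* k ℕ.* (d ℕ.* d ℕ.+ 1))) ÷ (12 ℕ.* a ℕ.* b))) - (i ÷ 1) * (v⁻¹ * ((+ (v ℕ.* k)) ÷ 12))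
      ≡⟨ cong₂ (λ x y → (i ÷ 1) * x - (i ÷ 1) * y) (scaled-main-term N c₀ d k v) (scaled-correction-term k v) ⟩
    (i ÷ 1) * (X * ((+ 1) ÷ (v ℕ.* v))) - (i ÷ 1) * ((+ k) ÷ 12)
      ≡⟨ rearrange (i ÷ 1) X ((+ 1) ÷ (v ℕ.* v)) ((+ k) ÷ 12) ⟩
    X * ((i ÷ 1) * ((+ 1) ÷ (v ℕ.* v))) - ((+ k) ÷ 12) * ((i ÷ 1) * 1ℚ) ∎
    where
    open ≡-Reasoning
    a = v ℕ.* c₀
    b = v ℕ.* c₀ ℕ.+ v ℕ.* k ℕ.* d
    v⁻¹ = (+ 1) ÷ v
    X = (+ (N ℕ.* N ℕ.* k ℕ.* (d ℕ.* d ℕ.+ 1))) ÷ (12 ℕ.* (c₀ ℕ.* N) ℕ.* (c₀ ℕ.* N ℕ.+ k ℕ.* N ℕ.* d))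
    i÷v≡ : i ÷ v ≡ (i ÷ 1) * v⁻¹
    i÷v≡ = sym (trans (÷-* i (+ 1) 1 v) (÷-cong (i ℤ.* + 1) i (1 ℕ.* v) v (cong₂ ℤ._*_ (ℤ.*-identityʳ i) (cong +_ (sym (ℕ.*-identityˡ v))))))
    distribute : ∀ m u x y → (m * u) * (x - y) ≡ m * (u * x) - m * (u * y)
    distribute = ℚ-solve 4 (λ m u x y → (m :* u) :* (x :- y) := m :* (u :* x) :- m :* (u :* y)) refl
    rearrange : ∀ m x f c → m * (x * f) - m * c ≡ x * (m * f) - c * (m * 1ℚ)
    rearrange = ℚ-solve 4 (λ m x f c → m :* (x :* f) :- m :* c := x :* (m :* f) :- c :* (m :* con 1ℚ)) refl

  divisor-summand : ∀ N c₀ d k {v} .{{_ : NonZero N}} .{{_ : NonZero c₀}} .{{_ : NonZero d}} →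
    Coprime (c₀ ℕ.* N) d → v ∣ N →
    (μ v ÷ v) * (dedekind (+ d) ((v ℕ.* (c₀ ℕ.* N)) div N) - dedekind (+ d) ((v ℕ.* (c₀ ℕ.* N)) div N ℕ.+ v ℕ.* k ℕ.* d))
    ≡ ((+ (N ℕ.* N ℕ.* k ℕ.* (d ℕ.* d ℕ.+ 1))) ÷ (12 ℕ.* (c₀ ℕ.* N) ℕ.* (c₀ ℕ.* N ℕ.+ k ℕ.* N ℕ.* d)))
        * ((μ v ÷ 1) * ((+ 1) ÷ (v ℕ.* v)))
      - ((+ k) ÷ 12) * ((μ v ÷ 1) * 1ℚ)
  divisor-summand N@(suc _) c₀ d k {v} c⊥d v∣N =
    trans (cong (λ a → (μ v ÷ v) * (dedekind (+ d) a - dedekind (+ d) (a ℕ.+ v ℕ.* k ℕ.* d))) vc/N≡vc₀)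
          (divisor-term (μ v) N c₀ d k v vc₀⊥d)
    where
    instance
      v≢0 : NonZero v
      v≢0 = divisor-nonZero v∣N
    vc/N≡vc₀ : (v ℕ.* (c₀ ℕ.* N)) div N ≡ v ℕ.* c₀
    vc/N≡vc₀ = trans (cong (ℕ._/ N) (sym (ℕ.*-assoc v c₀ N))) (m*n/n≡m (v ℕ.* c₀) N)
    vc₀⊥d : Coprime (v ℕ.* c₀) d
    vc₀⊥d (i∣vc₀ , i∣d) = c⊥d (∣-trans i∣vc₀ (subst (v ℕ.* c₀ ∣_) (ℕ.*-comm N c₀) (*-monoˡ-∣ c₀ v∣N)) , i∣d)

  inverse-square-multiplicative : ∀ a b .{{_ : NonZero a}} .{{_ : NonZero b}} →
    (+ 1) ÷ (a ℕ.* b ℕ.* (a ℕ.* b)) ≡ ((+ 1) ÷ (a ℕ.* a)) * ((+ 1) ÷ (b ℕ.* b))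
  inverse-square-multiplicative a@(suc _) b@(suc _) = sym (trans (÷-*-ℕ 1 1 (a ℕ.* a) (b ℕ.* b))
    (÷-cong-ℕ 1 1 (a ℕ.* a ℕ.* (b ℕ.* b)) (a ℕ.* b ℕ.* (a ℕ.* b)) (regroup a b)))
    where
    regroup : ∀ a b → 1 ℕ.* (a ℕ.* b ℕ.* (a ℕ.* b)) ≡ 1 ℕ.* (a ℕ.* a ℕ.* (b ℕ.* b))
    regroup = solve-∀

open import Defs
open import Data.Nat using (ℕ; _≤_; _+_; _*_)
open import Data.Nat.Divisibility using (_∣_)
open import Data.Nat.GCD using (gcd)
open import Data.Integer using (+_)
open import Data.Rational using (ℚ; 1ℚ) renaming (_*_ to _*ℚ_; _-_ to _-ℚ_)
open import Data.List using (map)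
open import Relation.Binary.PropositionalEquality using (_≡_)

open import Data.Nat.Base using (zero; suc; s≤s; z≤n)
open import Data.Nat.Divisibility using (divides)
open import Data.Nat.Coprimality using (gcd≡1⇒coprime)
open import Data.Rational using (0ℚ)
open import Data.Rational.Solver using (module +-*-Solver)
open +-*-Solver using (_:*_; _:-_; _:=_; con) renaming (solve to ℚ-solve)
open import Function.Base using (_∘_)
open import Relation.Binary.PropositionalEquality using (refl; trans; cong₂; module ≡-Reasoning)
open ListSums using (Σℚ-cong; Σℚ-linear)
open Mobius using (module DivisorSums; Π[1-1]≡0; ∈-divisors⁻)
open DivisorSum using (divisor-summand; inverse-square-multiplicative)

mainTheorem15 : (N c d k : ℕ) → 2 ≤ N → 1 ≤ c → 1 ≤ d → 1 ≤ k →
  gcd c d ≡ 1 → N ∣ c →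
  Σℚ (map (λ v → (μ v ÷ v) *ℚ
                   (dedekind (+ d) ((v * c) div N)
                     -ℚ dedekind (+ d) ((v * c) div N + v * k * d)))
          (divisors N))
    ≡ ((+ (N * N * k * (d * d + 1))) ÷ (12 * c * (c + k * N * d)))
      *ℚ Πℚ (map (λ p → 1ℚ -ℚ ((+ 1) ÷ (p * p))) (primeDivisors N))
mainTheorem15 (suc zero) _ _ _ (s≤s ())
mainTheorem15 _ _ zero _ _ _ ()
mainTheorem15 _ _ _ _ _ () _ _ _ (divides zero refl)
mainTheorem15 N@(suc (suc _)) _ d@(suc _) k _ _ _ _ gcd≡1 (divides c₀@(suc _) refl) = begin
  Σℚ (map T (divisors N))
    ≡⟨ Σℚ-cong (divisors N) (divisor-summand N c₀ d k (gcd≡1⇒coprime gcd≡1) ∘ ∈-divisors⁻) ⟩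
  Σℚ (map (λ v → X *ℚ G v -ℚ K *ℚ H v) (divisors N))
    ≡⟨ Σℚ-linear X K G H (divisors N) ⟩
  X *ℚ Σℚ (map G (divisors N)) -ℚ K *ℚ Σℚ (map H (divisors N))
    ≡⟨ cong₂ (λ s t → X *ℚ s -ℚ K *ℚ t) (DivisorSums.Σμ≡Π[1-F] (λ v → (+ 1) ÷ (v * v)) refl inverse-square-multiplicative N)
                                        (trans (DivisorSums.Σμ≡Π[1-F] (λ _ → 1ℚ) refl (λ _ _ → refl) N) (Π[1-1]≡0 N (s≤s (s≤s z≤n)))) ⟩
  X *ℚ Π -ℚ K *ℚ 0ℚ
    ≡⟨ ℚ-solve 3 (λ x p c → x :* p :- c :* con 0ℚ := x :* p) refl X Π K ⟩
  X *ℚ Π ∎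
  where
  open ≡-Reasoning
  c = c₀ * N
  T G H : ℕ → ℚ
  T v = (μ v ÷ v) *ℚ (dedekind (+ d) ((v * c) div N) -ℚ dedekind (+ d) ((v * c) div N + v * k * d))
  G v = (μ v ÷ 1) *ℚ ((+ 1) ÷ (v * v))
  H v = (μ v ÷ 1) *ℚ 1ℚ
  X = (+ (N * N * k * (d * d + 1))) ÷ (12 * c * (c + k * N * d))
  K = (+ k) ÷ 12
  Π = Πℚ (map (λ p → 1ℚ -ℚ ((+ 1) ÷ (p * p))) (primeDivisors N))
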